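{- For any $\varepsilon>0$ there exist $\beta=\beta(\varepsilon)>0$ and $n_0=n_0(\varepsilon)\in\mathbb{N}$ such that the following holds. For every tree $T$ with $|T|=n\geq n_0$ vertices and every subset $L\subset V(T)$, there are subtrees $S,T_1,T_2\subset T$ which cover $T$ (every vertex of $T$ lies in at least one of them) such that $|S|\leq\varepsilon n$, $S$ contains at least $\beta|L|$ vertices of $L$, and $T_1$ and $T_2$ are vertex-disjoint and each intersects $S$ in exactly one vertex.
   Context: $|T|$ denotes the number of vertices of $T$.
   Formalization: The parameter ε ranges over the positive rationals, and the constant β is taken in the rationals as well. -}

module Defs where

open import Data.Nat using (ℕ; _≤_)
open import Data.Fin using (Fin)
open import Data.Fin.Subset using (Subset; _∈_; ⊤; _∩_; ∣_∣)
open import Data.List using (List; length; _++_; take)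
open import Data.List.Relation.Unary.Unique.Propositional using (Unique)
open import Data.List.Relation.Unary.Linked using (Linked)
open import Data.Product using (_×_; ∃)
open import Relation.Nullary using (¬_)
open import Relation.Binary.PropositionalEquality using (_≡_)

data WalkIn {n : ℕ} (E : Fin n → Fin n → Set) (U : Subset n) : Fin n → Fin n → Set where
  here : ∀ {u} → u ∈ U → WalkIn E U u u
  step : ∀ {u w v} → u ∈ U → E u w → WalkIn E U w v → WalkIn E U u v

ConnectedIn : {n : ℕ} → (Fin n → Fin n → Set) → Subset n → Set
ConnectedIn {n} E U = ∃ (λ (x : Fin n) → x ∈ U)
  × (∀ u v → u ∈ U → v ∈ U → WalkIn E U u v)

-- A cycle: a list v₀ … v_{k-1} of k ≥ 3 distinct vertices with v_i ~ v_{i+1}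
-- and v_{k-1} ~ v₀.
IsCycle : {n : ℕ} → (Fin n → Fin n → Set) → List (Fin n) → Set
IsCycle E cs = 3 ≤ length cs × Unique cs × Linked E (cs ++ take 1 cs)

Acyclic : {n : ℕ} → (Fin n → Fin n → Set) → Set
Acyclic {n} E = ∀ (cs : List (Fin n)) → ¬ IsCycle E cs

IsTree : (n : ℕ) → (Fin n → Fin n → Set) → Set
IsTree n E = (∀ u v → E u v → E v u) × (∀ u → ¬ E u u) × ConnectedIn E ⊤ × Acyclic E

-- A subtree of a tree (given by its vertex set): a nonempty vertex set whose
-- induced subgraph is connected (in a tree, the subtree on a vertex set U is
-- necessarily the induced subgraph on U).
IsSubtree : {n : ℕ} → (Fin n → Fin n → Set) → Subset n → Set
IsSubtree E U = ConnectedIn E U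

module Submission where

-- The scan cuts the tree into pieces
-- (Pieces.Region): upward closed sets of fewer than 2k vertices all of whose
-- downward exits start at the top or at a single "hole".  Such a piece S yields
-- the required triple (Pieces.region→split): T₁ is the rest of the tree above
-- and beside S, T₂ the part below the hole.  A potential argument (Bookkeeping)
-- shows that the scan closes at most 3n/k < K = 12q + 1 pieces, so these
-- cannot all carry fewer than |L|/K vertices of L; hence the scan finds a
-- piece with |S| < 2k ≤ εn and |S ∩ L| ≥ |L|/K (Decomposition.main), and
-- β = 1/K, n₀ = 2q work.

open import Data.Nat using (ℕ; suc; _+_; _≤_)
open import Data.Fin using (Fin)
open import Data.Fin.Subset using (Subset)

module Booleans where

  open import Data.Nat using (_<_; _<ᵇ_)
  open import Data.Nat.Properties using (<ᵇ⇒<; <⇒<ᵇ)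
  open import Data.Unit using (tt)

  open import Data.Bool using (Bool; true; false; _∨_; _∧_; not; T)
  open import Data.Maybe using (nothing; just)
  open import Data.Fin using (Fin; _≟_)
  open import Data.Empty using (⊥; ⊥-elim)
  open import Data.Product using (_×_; _,_)
  open import Data.Sum using (_⊎_; inj₁; inj₂)
  open import Relation.Nullary using (yes; no)
  open import Relation.Nullary.Decidable using (⌊_⌋)
  open import Relation.Binary.PropositionalEquality using (_≡_; _≢_; refl; sym; subst)

  eqᵇ : ∀ {n} → Fin n → Fin n → Bool
  eqᵇ x y = ⌊ x ≟ y ⌋

  eqᵇ-sound : ∀ {n} {x y : Fin n} → eqᵇ x y ≡ true → x ≡ y
  eqᵇ-sound {x = x} {y} h with x ≟ y
  ... | yes e = e

  eqᵇ-refl : ∀ {n} (x : Fin n) → eqᵇ x x ≡ true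
  eqᵇ-refl x with x ≟ x
  ... | yes _ = refl
  ... | no x≢x = ⊥-elim (x≢x refl)

  eqᵇ-≢ : ∀ {n} {x y : Fin n} → x ≢ y → eqᵇ x y ≡ false
  eqᵇ-≢ {x = x} {y} x≢y with x ≟ y
  ... | yes e = ⊥-elim (x≢y e)
  ... | no _ = refl

  true≢false : ∀ {a} → a ≡ true → a ≡ false → ⊥
  true≢false refl ()

  eqᵇ-false : ∀ {n} {x y : Fin n} → eqᵇ x y ≡ false → x ≢ y
  eqᵇ-false {x = x} h refl = true≢false (eqᵇ-refl x) h

  ∨⁻ : ∀ {a b} → a ∨ b ≡ true → a ≡ true ⊎ b ≡ true
  ∨⁻ {true} _ = inj₁ refl
  ∨⁻ {false} h = inj₂ h

  ∨-false⁻ : ∀ {a b} → a ∨ b ≡ false → a ≡ false × b ≡ false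
  ∨-false⁻ {false} h = refl , h

  ∨-false : ∀ {a b} → a ≡ false → b ≡ false → a ∨ b ≡ false
  ∨-false refl refl = refl

  ∨-introˡ : ∀ {a b} → a ≡ true → a ∨ b ≡ true
  ∨-introˡ refl = refl

  ∨-introʳ : ∀ {a b} → b ≡ true → a ∨ b ≡ true
  ∨-introʳ {true} _ = refl
  ∨-introʳ {false} h = h

  ∧⁻ : ∀ {a b} → a ∧ b ≡ true → a ≡ true × b ≡ true
  ∧⁻ {true} {true} _ = refl , refl

  ∧-intro : ∀ {a b} → a ≡ true → b ≡ true → a ∧ b ≡ true
  ∧-intro refl refl = refl

  not⁻ : ∀ {a} → not a ≡ true → a ≡ false
  not⁻ {false} _ = refl

  not-intro : ∀ {a} → a ≡ false → not a ≡ true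
  not-intro refl = refl

  nothing≢just : ∀ {A : Set} {a : A} → nothing ≢ just a
  nothing≢just ()

  bool-cases : ∀ (a : Bool) → a ≡ false ⊎ a ≡ true
  bool-cases false = inj₁ refl
  bool-cases true = inj₂ refl

  <ᵇ-sound : ∀ m n → (m <ᵇ n) ≡ true → m < n
  <ᵇ-sound m n h = <ᵇ⇒< m n (subst T (sym h) tt)

  <ᵇ-complete : ∀ {m n} → m < n → (m <ᵇ n) ≡ true
  <ᵇ-complete {m} {n} h with m <ᵇ n | <⇒<ᵇ h
  ... | true | _ = refl

module Counting where

  open import Data.Nat
  open import Data.Nat.Properties
  open import Data.Bool using (Bool; true; false; _∨_; _∧_)
  open import Data.Fin using (Fin; zero; suc)
  import Data.Fin.Properties as Fin
  open import Data.Fin.Subset using (Subset; _∈_; _∩_; ∣_∣)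
  open import Data.Vec using (_∷_; []; lookup; tabulate)
  open import Data.Vec.Properties using (lookup∘tabulate; lookup-zipWith; []=⇒lookup; lookup⇒[]=)
  open import Data.Empty using (⊥; ⊥-elim)
  open import Data.Sum using ([_,_]′)
  open import Algebra.Properties.CommutativeSemigroup +-commutativeSemigroup using (interchange)
  open import Relation.Binary.PropositionalEquality
  open Booleans

  bit : Bool → ℕ
  bit true = 1
  bit false = 0

  count : ∀ {n} → (Fin n → Bool) → ℕ
  count {zero} A = 0
  count {suc n} A = bit (A zero) + count (λ x → A (suc x))

  ∣∣≡count : ∀ {n} (v : Subset n) → ∣ v ∣ ≡ count (lookup v)
  ∣∣≡count [] = refl
  ∣∣≡count (true ∷ v) = cong suc (∣∣≡count v)
  ∣∣≡count (false ∷ v) = ∣∣≡count v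

  count-cong : ∀ {n} (A B : Fin n → Bool) → (∀ x → A x ≡ B x) → count A ≡ count B
  count-cong {zero} A B h = refl
  count-cong {suc n} A B h = cong₂ _+_ (cong bit (h zero)) (count-cong _ _ (λ x → h (suc x)))

  count-mono : ∀ {n} (A B : Fin n → Bool) → (∀ x → A x ≡ true → B x ≡ true) → count A ≤ count B
  count-mono {zero} A B h = z≤n
  count-mono {suc n} A B h = +-mono-≤ (bit-mono (A zero) (B zero) (h zero)) (count-mono _ _ (λ x → h (suc x)))
    where
      bit-mono : ∀ a b → (a ≡ true → b ≡ true) → bit a ≤ bit b
      bit-mono false b _ = z≤n
      bit-mono true b h rewrite h refl = ≤-refl

  count-∪ : ∀ {n} (A B : Fin n → Bool) → count (λ x → A x ∨ B x) ≤ count A + count B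
  count-∪ {zero} A B = z≤n
  count-∪ {suc n} A B = ≤-trans
    (+-mono-≤ (bit-∨ (A zero) (B zero)) (count-∪ (λ x → A (suc x)) (λ x → B (suc x))))
    (≤-reflexive (interchange (bit (A zero)) (bit (B zero)) _ _))
    where
      bit-∨ : ∀ a b → bit (a ∨ b) ≤ bit a + bit b
      bit-∨ false b = ≤-refl
      bit-∨ true false = ≤-refl
      bit-∨ true true = s≤s z≤n

  count-disjoint : ∀ {n} (A B : Fin n → Bool) → (∀ x → A x ≡ true → B x ≡ true → ⊥) →
                   count A + count B ≤ count (λ x → A x ∨ B x)
  count-disjoint {zero} A B h = z≤n
  count-disjoint {suc n} A B h = ≤-trans
    (≤-reflexive (interchange (bit (A zero)) _ (bit (B zero)) _))
    (+-mono-≤ (bit-∨ (A zero) (B zero) (h zero)) (count-disjoint (λ x → A (suc x)) (λ x → B (suc x)) (λ x → h (suc x))))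
    where
      bit-∨ : ∀ a b → (a ≡ true → b ≡ true → ⊥) → bit a + bit b ≤ bit (a ∨ b)
      bit-∨ false b _ = ≤-refl
      bit-∨ true false _ = ≤-refl
      bit-∨ true true h = ⊥-elim (h refl refl)

  count-none : ∀ {n} (A : Fin n → Bool) → (∀ x → A x ≡ false) → count A ≡ 0
  count-none {zero} A h = refl
  count-none {suc n} A h rewrite h zero = count-none (λ x → A (suc x)) (λ x → h (suc x))

  count-one : ∀ {n} (A : Fin n → Bool) u → A u ≡ true → (∀ x → A x ≡ true → x ≡ u) → count A ≡ 1
  count-one {suc n} A zero Au only rewrite Au = cong suc (count-none _ rest)
    where
      rest : ∀ x → A (suc x) ≡ false
      rest x with A (suc x) in e
      ... | false = refl
      ... | true with only (suc x) e
      ... | ()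
  count-one {suc n} A (suc u) Au only with A zero in e
  ... | true with only zero e
  ... | ()
  count-one {suc n} A (suc u) Au only | false =
    count-one (λ x → A (suc x)) u Au (λ x e → Fin.suc-injective (only (suc x) e))

  count≤n : ∀ {n} (A : Fin n → Bool) → count A ≤ n
  count≤n {zero} A = z≤n
  count≤n {suc n} A with A zero
  ... | true = s≤s (count≤n _)
  ... | false = m≤n⇒m≤1+n (count≤n _)

  count-split : ∀ {n} (A B C : Fin n → Bool) → (∀ x → A x ≡ true → B x ≡ true → ⊥) →
                (∀ x → A x ≡ true → C x ≡ true) → (∀ x → B x ≡ true → C x ≡ true) → count A + count B ≤ count C
  count-split A B C d ha hb = ≤-trans (count-disjoint A B d) (count-mono _ C λ x h → [ ha x , hb x ]′ (∨⁻ h))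

  ∈-tabulate⁺ : ∀ {n} (A : Fin n → Bool) x → A x ≡ true → x ∈ tabulate A
  ∈-tabulate⁺ A x h = lookup⇒[]= x (tabulate A) (trans (lookup∘tabulate A x) h)

  ∈-tabulate⁻ : ∀ {n} (A : Fin n → Bool) x → x ∈ tabulate A → A x ≡ true
  ∈-tabulate⁻ A x h = trans (sym (lookup∘tabulate A x)) ([]=⇒lookup h)

  ∣tabulate∣ : ∀ {n} (A : Fin n → Bool) → ∣ tabulate A ∣ ≡ count A
  ∣tabulate∣ A = trans (∣∣≡count (tabulate A)) (count-cong _ _ (lookup∘tabulate A))

  ∣tabulate∩∣ : ∀ {n} (A : Fin n → Bool) (v : Subset n) → ∣ tabulate A ∩ v ∣ ≡ count (λ x → A x ∧ lookup v x)
  ∣tabulate∩∣ A v = trans (∣∣≡count (tabulate A ∩ v)) (count-cong _ _ λ x →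
    trans (lookup-zipWith _∧_ x (tabulate A) v) (cong (_∧ lookup v x) (lookup∘tabulate A x)))

  ∣tabulate∩tabulate∣ : ∀ {n} (A B : Fin n → Bool) → ∣ tabulate A ∩ tabulate B ∣ ≡ count (λ x → A x ∧ B x)
  ∣tabulate∩tabulate∣ A B = trans (∣tabulate∩∣ A (tabulate B)) (count-cong _ _ λ x → cong (A x ∧_) (lookup∘tabulate B x))

module RootedTrees where

  open import Data.Nat hiding (_≟_)
  open import Data.Nat.Properties hiding (_≟_)
  open import Data.Bool using (Bool; true)
  open import Data.Fin using (Fin; _≟_; toℕ)
  open import Data.Fin.Properties using (pigeonhole; toℕ<n)
  open import Data.Empty using (⊥-elim)
  open import Data.Product using (_×_; _,_; proj₁; proj₂)
  open import Relation.Nullary using (¬_; yes; no)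
  open import Relation.Nullary.Decidable using (⌊_⌋)
  open import Relation.Binary.PropositionalEquality
  open import Data.Fin.Subset using (_∈_)
  open import Data.Vec using (tabulate)
  open import Defs using (WalkIn; here; step; ConnectedIn)
  open Counting using (∈-tabulate⁺; ∈-tabulate⁻)

  record Rooting {n : ℕ} (E : Fin n → Fin n → Set) : Set where
    field
      root : Fin n
      parent : Fin n → Fin n
      depth : Fin n → ℕ
      parent-root : parent root ≡ root
      depth-root : depth root ≡ 0
      depth-parent : ∀ x → x ≢ root → depth x ≡ suc (depth (parent x))
      parent-edge : ∀ x → x ≢ root → E x (parent x)

  module Rooted {n : ℕ} {E : Fin n → Fin n → Set} (E-sym : ∀ u v → E u v → E v u) (ρ : Rooting E) where

    open Rooting ρ public

    -- ancestor k x: the k-th ancestor of x (the root is its own parent).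
    ancestor : ℕ → Fin n → Fin n
    ancestor zero x = x
    ancestor (suc k) x = ancestor k (parent x)

    -- Valid also at the root, where both sides are 0.
    depth-parent∸ : ∀ x → depth (parent x) ≡ depth x ∸ 1
    depth-parent∸ x with x ≟ root
    ... | yes refl = trans (cong depth parent-root) dep-r' 
      where dep-r' : depth x ≡ depth x ∸ 1
            dep-r' = trans depth-root (cong (_∸ 1) (sym depth-root))
    ... | no ne rewrite depth-parent x ne = refl

    depth-ancestor : ∀ k x → depth (ancestor k x) ≡ depth x ∸ k
    depth-ancestor zero x = refl
    depth-ancestor (suc k) x rewrite depth-ancestor k (parent x) | depth-parent∸ x = ∸-+-assoc (depth x) 1 k

    depth≡0⇒root : ∀ x → depth x ≡ 0 → x ≡ root
    depth≡0⇒root x h with x ≟ root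
    ... | yes e = e
    ... | no ne with trans (sym h) (depth-parent x ne)
    ... | ()

    ancestor-root : ∀ k → ancestor k root ≡ root
    ancestor-root zero = refl
    ancestor-root (suc k) = trans (cong (ancestor k) parent-root) (ancestor-root k)

    ancestor-+ : ∀ a b x → ancestor (a + b) x ≡ ancestor a (ancestor b x)
    ancestor-+ a zero x rewrite +-identityʳ a = refl
    ancestor-+ a (suc b) x rewrite +-suc a b = ancestor-+ a b (parent x)

    -- x ≼ u: x lies in the subtree of u, i.e. u is the ancestor of x at the depth of u.
    _≼_ : Fin n → Fin n → Set
    x ≼ u = ancestor (depth x ∸ depth u) x ≡ u

    subtreeᵇ : Fin n → Fin n → Bool
    subtreeᵇ u x = ⌊ ancestor (depth x ∸ depth u) x ≟ u ⌋

    subtreeᵇ-sound : ∀ u x → subtreeᵇ u x ≡ true → x ≼ u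
    subtreeᵇ-sound u x h with ancestor (depth x ∸ depth u) x ≟ u
    ... | yes e = e
    subtreeᵇ-sound u x () | no _

    subtreeᵇ-complete : ∀ u x → x ≼ u → subtreeᵇ u x ≡ true
    subtreeᵇ-complete u x h with ancestor (depth x ∸ depth u) x ≟ u
    ... | yes e = refl
    ... | no ne = ⊥-elim (ne h)

    ≼-refl : ∀ u → u ≼ u
    ≼-refl u rewrite n∸n≡0 (depth u) = refl

    ≼-depth : ∀ {x u} → x ≼ u → depth u ≤ depth x
    ≼-depth {x} {u} h = subst (_≤ depth x) (trans (sym (depth-ancestor (depth x ∸ depth u) x)) (cong depth h)) (m∸n≤m (depth x) (depth x ∸ depth u))

    ≼-same-depth : ∀ {x u} → x ≼ u → depth x ≡ depth u → x ≡ u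
    ≼-same-depth {x} {u} h e = subst (λ k → ancestor k x ≡ u) (trans (cong (_∸ depth u) e) (n∸n≡0 (depth u))) h

    ≼-parent : ∀ {x u} → x ≼ u → x ≢ u → parent x ≼ u
    ≼-parent {x} {u} h ne with depth x ∸ depth u in eq
    ... | zero = ⊥-elim (ne h)
    ... | suc k = subst (λ j → ancestor j (parent x) ≡ u) (sym e2) h
      where e2 : depth (parent x) ∸ depth u ≡ k
            e2 = begin
              depth (parent x) ∸ depth u ≡⟨ cong (_∸ depth u) (depth-parent∸ x) ⟩
              depth x ∸ 1 ∸ depth u ≡⟨ ∸-+-assoc (depth x) 1 (depth u) ⟩
              depth x ∸ suc (depth u) ≡⟨ sym (pred[m∸n]≡m∸[1+n] (depth x) (depth u)) ⟩
              pred (depth x ∸ depth u) ≡⟨ cong pred eq ⟩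
              k ∎
              where open ≡-Reasoning

    ≼-unparent : ∀ {x u} → parent x ≼ u → x ≢ root → x ≼ u
    ≼-unparent {x} {u} h nr = subst (λ j → ancestor j x ≡ u) (sym e2) h
      where e2 : depth x ∸ depth u ≡ suc (depth (parent x) ∸ depth u)
            e2 = trans (cong (_∸ depth u) (depth-parent x nr)) (+-∸-assoc 1 (≼-depth h))

    ≼-trans : ∀ {x p u} → x ≼ p → p ≼ u → x ≼ u
    ≼-trans {x} {p} {u} h1 h2 = trans (cong (λ j → ancestor j x) e) (trans (ancestor-+ (depth p ∸ depth u) (depth x ∸ depth p) x) (trans (cong (ancestor (depth p ∸ depth u)) h1) h2))
      where d1 = ≼-depth h1
            d2 = ≼-depth h2
            e : depth x ∸ depth u ≡ (depth p ∸ depth u) + (depth x ∸ depth p)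
            e = begin
              depth x ∸ depth u ≡⟨ cong (_∸ depth u) (sym (m∸n+n≡m d1)) ⟩
              (depth x ∸ depth p) + depth p ∸ depth u ≡⟨ +-∸-assoc (depth x ∸ depth p) d2 ⟩
              (depth x ∸ depth p) + (depth p ∸ depth u) ≡⟨ +-comm (depth x ∸ depth p) _ ⟩
              (depth p ∸ depth u) + (depth x ∸ depth p) ∎
              where open ≡-Reasoning

    ≼-antisym : ∀ {x u} → x ≼ u → u ≼ x → x ≡ u
    ≼-antisym h1 h2 = ≼-same-depth h1 (≤-antisym (≼-depth h2) (≼-depth h1))

    parent⋠ : ∀ {u} → u ≢ root → ¬ (parent u ≼ u)
    parent⋠ {u} nr h = <-irrefl refl (≤-trans (s≤s (≼-depth h)) (≤-reflexive (sym (depth-parent u nr))))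

    ≼-root : ∀ x → x ≼ root
    ≼-root x = subst (λ j → ancestor (depth x ∸ j) x ≡ root) (sym depth-root) (depth≡0⇒root _ (trans (depth-ancestor (depth x) x) (n∸n≡0 (depth x))))

    Child : Fin n → Fin n → Set
    Child u c = c ≢ root × parent c ≡ u

    childToward : Fin n → Fin n → Fin n
    childToward u x = ancestor (depth x ∸ suc (depth u)) x

    ≼-nonroot : ∀ {x c} → x ≼ c → c ≢ root → x ≢ root
    ≼-nonroot {x} {c} h cr e = cr (≼-antisym (≼-root c) (subst (_≼ c) e h))

    depth-child : ∀ {u c} → Child u c → depth c ≡ suc (depth u)
    depth-child {u} {c} (cr , pc) = trans (depth-parent c cr) (cong (λ z → suc (depth z)) pc)

    child-subtree : ∀ {u c x} → Child u c → x ≼ c → x ≼ u × x ≢ u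
    child-subtree {u} {c} {x} ch h = ≼-trans h cu , λ e → 1+n≰n (subst (λ z → suc (depth u) ≤ depth z) e (≤-trans (≤-reflexive (sym (depth-child ch))) (≼-depth h)))
      where cu : c ≼ u
            cu = ≼-unparent (subst (_≼ u) (sym (proj₂ ch)) (≼-refl u)) (proj₁ ch)

    parent⋠child : ∀ {u c} → Child u c → ¬ (u ≼ c)
    parent⋠child ch h = proj₂ (child-subtree ch h) refl

    childToward-unique : ∀ {u c x} → Child u c → x ≼ c → childToward u x ≡ c
    childToward-unique {u} {c} {x} ch h = subst (λ j → ancestor (depth x ∸ j) x ≡ c) (depth-child ch) h

    childToward-spec : ∀ {u x} → x ≼ u → x ≢ u → Child u (childToward u x) × x ≼ childToward u x
    childToward-spec {u} {x} h ne = (cr , pc) , xin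
      where
        du<dx : depth u < depth x
        du<dx = ≤∧≢⇒< (≼-depth h) (λ e → ne (≼-same-depth h (sym e)))
        c : Fin n
        c = childToward u x
        dc : depth c ≡ suc (depth u)
        dc = trans (depth-ancestor (depth x ∸ suc (depth u)) x) (m∸[m∸n]≡n du<dx)
        cr : c ≢ root
        cr e with trans (sym dc) (trans (cong depth e) depth-root)
        ... | ()
        j : ℕ
        j = depth x ∸ suc (depth u)
        pc : parent c ≡ u
        pc = trans (sym (ancestor-+ 1 j x)) (trans (cong (λ z → ancestor z x) (sym (+-∸-assoc 1 du<dx))) h)
        xin : x ≼ c
        xin = subst (λ z → ancestor (depth x ∸ z) x ≡ c) (sym dc) refl

    walk-start : ∀ {U a b} → WalkIn E U a b → a ∈ U
    walk-start (here m) = m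
    walk-start (step m _ _) = m

    walk-++ : ∀ {U a b c} → WalkIn E U a b → WalkIn E U b c → WalkIn E U a c
    walk-++ (here m) w = w
    walk-++ (step m e w) w' = step m e (walk-++ w w')

    walk-reverse : ∀ {U a b} → WalkIn E U a b → WalkIn E U b a
    walk-reverse (here m) = here m
    walk-reverse (step m e w) = walk-++ (walk-reverse w) (step (walk-start w) (E-sym _ _ e) (here m))

    walk-to-ancestor : ∀ (U : Fin n → Bool) c → (∀ x → U x ≡ true → x ≢ c → U (parent x) ≡ true) →
              ∀ k x → ancestor k x ≡ c → U x ≡ true → WalkIn E (tabulate U) x c
    walk-to-ancestor U c cl zero x h ux rewrite h = here (∈-tabulate⁺ U c ux)
    walk-to-ancestor U c cl (suc k) x h ux with x ≟ c
    ... | yes refl = here (∈-tabulate⁺ U x ux)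
    ... | no ne = step (∈-tabulate⁺ U x ux) (parent-edge x xr) (walk-to-ancestor U c cl k (parent x) h (cl x ux ne))
      where xr : x ≢ root
            xr refl = ne (trans (sym (ancestor-root (suc k))) h)

    upward-closed-connected : ∀ (U : Fin n → Bool) c → U c ≡ true → (∀ x → U x ≡ true → x ≼ c) →
                (∀ x → U x ≡ true → x ≢ c → U (parent x) ≡ true) → ConnectedIn E (tabulate U)
    upward-closed-connected U c uc sub cl = (c , ∈-tabulate⁺ U c uc) , λ u v mu mv →
      walk-++ (up u mu) (walk-reverse (up v mv))
      where up : ∀ x → x ∈ tabulate U → WalkIn E (tabulate U) x c
            up x m = walk-to-ancestor U c cl (depth x ∸ depth c) x (sub x (∈-tabulate⁻ U x m)) (∈-tabulate⁻ U x m)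

    -- Depths are bounded by n: the ancestors of x at distinct heights are distinct.
    depth<n : ∀ x → depth x < n
    depth<n x with depth x <? n
    ... | yes p = p
    ... | no np with pigeonhole (s≤s (≮⇒≥ np)) (λ (i : Fin (suc (depth x))) → ancestor (toℕ i) x)
    ... | i , j , i<j , e = ⊥-elim (<-irrefl ij i<j)
      where
        ij : toℕ i ≡ toℕ j
        ij = ∸-cancelˡ-≡ (s≤s⁻¹ (toℕ<n i)) (s≤s⁻¹ (toℕ<n j))
               (trans (sym (depth-ancestor (toℕ i) x)) (trans (cong depth e) (depth-ancestor (toℕ j) x)))

-- Every connected graph has a rooting: grow a rooted tree from the root,
-- attaching the vertices of a walk to the root one at a time, back to front.
module SpanningTree where

  open import Data.Nat hiding (_≟_)
  open import Data.Nat.Properties hiding (_≟_)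
  open import Data.Bool using (Bool; true; false; _∨_; if_then_else_)
  open import Data.Fin using (Fin; toℕ; fromℕ<)
  open import Data.Fin.Properties using (toℕ-injective; toℕ<n; toℕ-fromℕ<)
  open import Data.Empty using (⊥-elim)
  open import Data.Product using (Σ; _×_; _,_; proj₁; proj₂)
  open import Data.Sum using (inj₁; inj₂)
  open import Relation.Nullary using (yes; no)
  open import Relation.Binary.PropositionalEquality
  open import Data.Fin.Subset using (⊤)
  open import Data.Fin.Subset.Properties using (∈⊤)
  open import Defs using (WalkIn; here; step; ConnectedIn)
  open Booleans
  open RootedTrees using (Rooting)

  record PartialRooting {n} (E : Fin n → Fin n → Set) (root : Fin n) : Set where
    field
      Dom : Fin n → Bool
      parent : Fin n → Fin n
      depth : Fin n → ℕ
      root∈Dom : Dom root ≡ true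
      parent-root : parent root ≡ root
      depth-root : depth root ≡ 0
      closed : ∀ x → Dom x ≡ true → x ≢ root →
               Dom (parent x) ≡ true × E x (parent x) × depth x ≡ suc (depth (parent x))

  module _ {n} (E : Fin n → Fin n → Set) (root : Fin n) where

    Extends : PartialRooting E root → PartialRooting E root → Set
    Extends s s' = ∀ x → PartialRooting.Dom s x ≡ true → PartialRooting.Dom s' x ≡ true

    if-≢ : ∀ {A : Set} {x y : Fin n} (a b : A) → x ≢ y → (if eqᵇ x y then a else b) ≡ b
    if-≢ a b x≢y rewrite eqᵇ-≢ x≢y = refl

    if-≡ : ∀ {A : Set} (x : Fin n) (a b : A) → (if eqᵇ x x then a else b) ≡ a
    if-≡ x a b rewrite eqᵇ-refl x = refl

    attach : (s : PartialRooting E root) → ∀ y z → PartialRooting.Dom s y ≡ false →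
             PartialRooting.Dom s z ≡ true → E y z →
             Σ (PartialRooting E root) λ s' → PartialRooting.Dom s' y ≡ true × Extends s s'
    attach s y z y∉ z∈ yz = s' , ∨-introˡ (eqᵇ-refl y) , (λ x h → ∨-introʳ h)
      where
        open PartialRooting s
        ≢y : ∀ {x} → Dom x ≡ true → x ≢ y
        ≢y h refl = true≢false h y∉
        Dom' : Fin n → Bool
        Dom' x = eqᵇ x y ∨ Dom x
        parent' : Fin n → Fin n
        parent' x = if eqᵇ x y then z else parent x
        depth' : Fin n → ℕ
        depth' x = if eqᵇ x y then suc (depth z) else depth x
        closed' : ∀ x → Dom' x ≡ true → x ≢ root →
                  Dom' (parent' x) ≡ true × E x (parent' x) × depth' x ≡ suc (depth' (parent' x))
        closed' x h x≢root with ∨⁻ {eqᵇ x y} h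
        ... | inj₁ e rewrite eqᵇ-sound e | if-≡ y z (parent y) | if-≡ y (suc (depth z)) (depth y)
                           | if-≢ (suc (depth z)) (depth z) (≢y z∈) = ∨-introʳ z∈ , yz , refl
        ... | inj₂ x∈ with closed x x∈ x≢root
        ... | p∈ , edge , deep rewrite if-≢ z (parent x) (≢y x∈) | if-≢ (suc (depth z)) (depth x) (≢y x∈)
                                      | if-≢ (suc (depth z)) (depth (parent x)) (≢y p∈) = ∨-introʳ p∈ , edge , deep
        s' : PartialRooting E root
        s' = record { Dom = Dom' ; parent = parent' ; depth = depth' ; root∈Dom = ∨-introʳ root∈Dom
                    ; parent-root = trans (if-≢ z (parent root) (≢y root∈Dom)) parent-root
                    ; depth-root = trans (if-≢ (suc (depth z)) (depth root) (≢y root∈Dom)) depth-root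
                    ; closed = closed' }

    absorb : ∀ {U x} → WalkIn E U x root → (s : PartialRooting E root) →
             Σ (PartialRooting E root) λ s' → PartialRooting.Dom s' x ≡ true × Extends s s'
    absorb (here _) s = s , PartialRooting.root∈Dom s , λ _ h → h
    absorb {x = x} (step {w = w} _ xw walk) s with absorb walk s
    ... | s₁ , w∈ , s⊑s₁ with PartialRooting.Dom s₁ x in x∈
    ...   | true = s₁ , x∈ , s⊑s₁
    ...   | false with attach s₁ x w x∈ w∈ xw
    ...     | s₂ , x∈₂ , s₁⊑s₂ = s₂ , x∈₂ , λ z h → s₁⊑s₂ z (s⊑s₁ z h)

    trivial : PartialRooting E root
    trivial = record { Dom = eqᵇ root ; parent = λ _ → root ; depth = λ _ → 0 ; root∈Dom = eqᵇ-refl root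
                     ; parent-root = refl ; depth-root = refl
                     ; closed = λ x h x≢root → ⊥-elim (x≢root (sym (eqᵇ-sound h))) }

    cover-prefix : (∀ x → WalkIn E ⊤ x root) → ∀ i → i ≤ n →
                   Σ (PartialRooting E root) λ s → ∀ x → toℕ x < i → PartialRooting.Dom s x ≡ true
    cover-prefix walks zero _ = trivial , λ x ()
    cover-prefix walks (suc i) i<n with cover-prefix walks i (≤-trans (n≤1+n i) i<n)
    ... | s , covers with absorb (walks (fromℕ< i<n)) s
    ... | s' , new∈ , s⊑s' = s' , covers'
      where
        covers' : ∀ x → toℕ x < suc i → PartialRooting.Dom s' x ≡ true
        covers' x x<1+i with toℕ x Data.Nat.≟ i
        ... | yes e = subst (λ z → PartialRooting.Dom s' z ≡ true) (toℕ-injective (trans (toℕ-fromℕ< i<n) (sym e))) new∈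
        ... | no x≢i = s⊑s' x (covers x (≤∧≢⇒< (s≤s⁻¹ x<1+i) x≢i))

  rooting : ∀ {n} (E : Fin n → Fin n → Set) → ConnectedIn E ⊤ → Rooting E
  rooting {n} E ((root , _) , walks) = record
    { root = root ; parent = parent ; depth = depth ; parent-root = parent-root ; depth-root = depth-root
    ; depth-parent = λ x x≢root → proj₂ (proj₂ (closed x (everywhere x) x≢root))
    ; parent-edge = λ x x≢root → proj₁ (proj₂ (closed x (everywhere x) x≢root)) }
    where
      spanning = cover-prefix E root (λ x → walks x root ∈⊤ ∈⊤) n ≤-refl
      open PartialRooting (proj₁ spanning)
      everywhere : ∀ x → Dom x ≡ true
      everywhere x = proj₂ spanning x (toℕ<n x)

module Pieces {n : ℕ} {E : Fin n → Fin n → Set} (E-sym : ∀ u v → E u v → E v u)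
              (ρ : RootedTrees.Rooting E) (L : Subset n) where

  open import Data.Nat hiding (_≟_)
  open import Data.Nat.Properties hiding (_≟_)
  open import Data.Bool using (Bool; true; false; _∨_; _∧_; not)
  open import Data.Bool.Properties using (∨-zeroʳ)
  open import Data.Fin using (_≟_)
  open import Data.Fin.Properties using (any?)
  open import Data.Empty using (⊥; ⊥-elim)
  open import Data.Product using (Σ; ∃; _×_; _,_; proj₁; proj₂)
  open import Data.Maybe using (Maybe; just; nothing)
  open import Data.Maybe.Properties using (just-injective)
  open import Data.Sum using (_⊎_; inj₁; inj₂; [_,_]′)
  open import Relation.Nullary using (¬_; yes; no)
  open import Relation.Nullary.Decidable using (_×-dec_; ¬?)
  open import Relation.Binary.PropositionalEquality
  open import Data.Fin.Subset using (_∈_; _∩_; ∣_∣)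
  open import Data.Vec using (tabulate; lookup)
  open import Defs using (IsSubtree)
  open Booleans
  open Counting
  open RootedTrees.Rooted E-sym ρ public

  inL : Fin n → Bool
  inL = lookup L

  mass : (Fin n → Bool) → ℕ
  mass A = count (λ x → A x ∧ inL x)

  mass-mono : ∀ (A B : Fin n → Bool) → (∀ x → A x ≡ true → B x ≡ true) → mass A ≤ mass B
  mass-mono A B h = count-mono _ _ λ x e → let (a , l) = ∧⁻ {A x} e in ∧-intro (h x a) l

  mass-∪ : ∀ (A B C : Fin n → Bool) → (∀ x → C x ≡ true → A x ≡ true ⊎ B x ≡ true) → mass C ≤ mass A + mass B
  mass-∪ A B C h = ≤-trans (count-mono _ _ λ x e → let (c , l) = ∧⁻ {C x} e in
                     [ (λ a → ∨-introˡ (∧-intro a l)) , (λ b → ∨-introʳ (∧-intro b l)) ]′ (h x c)) (count-∪ (λ x → A x ∧ inL x) (λ x → B x ∧ inL x))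

  mass-split : ∀ (A B C : Fin n → Bool) → (∀ x → A x ≡ true → B x ≡ true → ⊥) →
              (∀ x → A x ≡ true → C x ≡ true) → (∀ x → B x ≡ true → C x ≡ true) → mass A + mass B ≤ mass C
  mass-split A B C d ha hb = count-split (λ x → A x ∧ inL x) (λ x → B x ∧ inL x) (λ x → C x ∧ inL x) (λ x e1 e2 → d x (proj₁ (∧⁻ {A x} e1)) (proj₁ (∧⁻ {B x} e2)))
     (λ x e → let (a , l) = ∧⁻ {A x} e in ∧-intro (ha x a) l) (λ x e → let (b , l) = ∧⁻ {B x} e in ∧-intro (hb x b) l)

  mass-none : ∀ (A : Fin n → Bool) → (∀ x → A x ≡ false) → mass A ≡ 0
  mass-none A h = count-none _ λ x → cong (_∧ inL x) (h x)

  Split : ℕ → ℕ → Set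
  Split M w = ∃ λ S → ∃ λ T₁ → ∃ λ T₂ →
        IsSubtree E S × IsSubtree E T₁ × IsSubtree E T₂
        × (∀ (v : Fin n) → v ∈ S ⊎ (v ∈ T₁ ⊎ v ∈ T₂))
        × (∣ S ∣ ≤ M)
        × (w ≤ ∣ S ∩ L ∣)
        × (∀ (v : Fin n) → ¬ (v ∈ T₁ × v ∈ T₂))
        × ∣ S ∩ T₁ ∣ ≡ 1
        × ∣ S ∩ T₂ ∣ ≡ 1

  Split-weaken : ∀ {M w w'} → w' ≤ w → Split M w → Split M w'
  Split-weaken w'≤w (S , T₁ , T₂ , a , b , c , d , e , w≤ , f) = S , T₁ , T₂ , a , b , c , d , e , ≤-trans w'≤w w≤ , f

  record TwoEnded : Set where
    field
      a p : Fin n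
      R : Fin n → Bool
      a∈R : R a ≡ true
      p∈R : R p ≡ true
      p≢a : p ≢ a
      R-below : ∀ x → R x ≡ true → x ≼ a
      R-upward : ∀ x → R x ≡ true → x ≢ a → R (parent x) ≡ true
      R-exits : ∀ x → R x ≡ false → R (parent x) ≡ true → x ≢ root → parent x ≡ a ⊎ parent x ≡ p

  module Complement (c : TwoEnded) where

    open TwoEnded c

    T₁ T₂ : Fin n → Bool
    T₁ x = eqᵇ x a ∨ (not (R x) ∧ not (subtreeᵇ p x))
    T₂ x = eqᵇ x p ∨ (subtreeᵇ p x ∧ not (R x))

    p≼a : p ≼ a
    p≼a = R-below p p∈R

    p≢root : p ≢ root
    p≢root e = p≢a (≼-antisym p≼a (subst (a ≼_) (sym e) (≼-root a)))

    a∈T₁ : T₁ a ≡ true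
    a∈T₁ rewrite eqᵇ-refl a = refl

    p∈T₂ : T₂ p ≡ true
    p∈T₂ rewrite eqᵇ-refl p = refl

    T₂-below : ∀ x → T₂ x ≡ true → x ≼ p
    T₂-below x h with ∨⁻ {eqᵇ x p} h
    ... | inj₁ e rewrite eqᵇ-sound e = ≼-refl p
    ... | inj₂ e = subtreeᵇ-sound p x (proj₁ (∧⁻ e))

    -- The parent of a vertex of T₂ other than p lies in T₂: if it lay in R,
    -- the edge would leave R from p (it cannot leave from a, which is above p).
    T₂-upward : ∀ x → T₂ x ≡ true → x ≢ p → T₂ (parent x) ≡ true
    T₂-upward x h x≢p with ∨⁻ {eqᵇ x p} h
    ... | inj₁ e = ⊥-elim (x≢p (eqᵇ-sound e))
    ... | inj₂ e with ∧⁻ {subtreeᵇ p x} e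
    ... | x≼ᵇp , x∉R = by-cases (R (parent x)) refl
      where
        x≼p : x ≼ p
        x≼p = subtreeᵇ-sound p x x≼ᵇp
        x≢root : x ≢ root
        x≢root e = p≢root (≼-antisym (≼-root p) (subst (_≼ p) e x≼p))
        px≼p : parent x ≼ p
        px≼p = ≼-parent x≼p x≢p
        by-cases : ∀ b → R (parent x) ≡ b → T₂ (parent x) ≡ true
        by-cases true px∈R with R-exits x (not⁻ x∉R) px∈R x≢root
        ... | inj₁ e = ⊥-elim (p≢a (≼-antisym p≼a (subst (_≼ p) e px≼p)))
        ... | inj₂ e rewrite e | eqᵇ-refl p = refl
        by-cases false px∉R rewrite px∉R | subtreeᵇ-complete p (parent x) px≼p = ∨-zeroʳ (eqᵇ (parent x) p)

    root∈T₁ : T₁ root ≡ true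
    root∈T₁ with root ≟ a
    ... | yes e = refl
    ... | no root≢a with R root in e
    ... | true = ⊥-elim (root≢a (sym (≼-antisym (≼-root a) (R-below root e))))
    ... | false with subtreeᵇ p root in e'
    ... | true = ⊥-elim (p≢root (≼-antisym (≼-root p) (subtreeᵇ-sound p root e')))
    ... | false = refl

    -- The parent of a vertex of T₁ lies in T₁: the parent of a is outside R and
    -- outside the subtree of p, and an edge from T₁ ∖ {a} into R leaves from a.
    T₁-upward : ∀ x → T₁ x ≡ true → x ≢ root → T₁ (parent x) ≡ true
    T₁-upward x h x≢root with ∨⁻ {eqᵇ x a} h
    ... | inj₁ e rewrite eqᵇ-sound e = parent-of-a
      where
        parent-of-a : T₁ (parent a) ≡ true
        parent-of-a with R (parent a) in e₁
        ... | true = ⊥-elim (parent⋠ x≢root (R-below (parent a) e₁))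
        ... | false with subtreeᵇ p (parent a) in e₂
        ... | true = ⊥-elim (parent⋠ x≢root (≼-trans (subtreeᵇ-sound p (parent a) e₂) p≼a))
        ... | false = ∨-zeroʳ (eqᵇ (parent a) a)
    ... | inj₂ e with ∧⁻ {not (R x)} e
    ... | x∉R , x⋠p with R (parent x) in e₁
    ... | true with R-exits x (not⁻ x∉R) e₁ x≢root
    ... | inj₁ e₂ rewrite e₂ | eqᵇ-refl a = refl
    ... | inj₂ e₂ = ⊥-elim (true≢false (subtreeᵇ-complete p x (≼-unparent (subst (_≼ p) (sym e₂) (≼-refl p)) x≢root)) (not⁻ x⋠p))
    T₁-upward x h x≢root | inj₂ e | x∉R , x⋠p | false with subtreeᵇ p (parent x) in e₃
    ... | true = ⊥-elim (true≢false (subtreeᵇ-complete p x (≼-unparent (subtreeᵇ-sound p (parent x) e₃) x≢root)) (not⁻ x⋠p))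
    ... | false = ∨-zeroʳ (eqᵇ (parent x) a)

    covers : ∀ v → v ∈ tabulate R ⊎ (v ∈ tabulate T₁ ⊎ v ∈ tabulate T₂)
    covers v with R v in e₁
    ... | true = inj₁ (∈-tabulate⁺ R v e₁)
    ... | false with subtreeᵇ p v in e₂
    ... | true = inj₂ (inj₂ (∈-tabulate⁺ T₂ v (subst (λ b → eqᵇ v p ∨ b ≡ true) (sym (cong₂ _∧_ e₂ (cong not e₁))) (∨-zeroʳ (eqᵇ v p)))))
    ... | false = inj₂ (inj₁ (∈-tabulate⁺ T₁ v (subst (λ b → eqᵇ v a ∨ b ≡ true) (sym (cong₂ _∧_ (cong not e₁) (cong not e₂))) (∨-zeroʳ (eqᵇ v a)))))

    disjoint : ∀ v → ¬ (v ∈ tabulate T₁ × v ∈ tabulate T₂)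
    disjoint v (v∈T₁ , v∈T₂) with ∨⁻ {eqᵇ v a} (∈-tabulate⁻ T₁ v v∈T₁) | ∨⁻ {eqᵇ v p} (∈-tabulate⁻ T₂ v v∈T₂)
    ... | inj₁ e₁ | inj₁ e₂ = p≢a (trans (sym (eqᵇ-sound e₂)) (eqᵇ-sound e₁))
    ... | inj₁ e₁ | inj₂ e₂ rewrite eqᵇ-sound e₁ = true≢false a∈R (not⁻ (proj₂ (∧⁻ {subtreeᵇ p a} e₂)))
    ... | inj₂ e₁ | inj₁ e₂ rewrite eqᵇ-sound e₂ = true≢false p∈R (not⁻ (proj₁ (∧⁻ {not (R p)} e₁)))
    ... | inj₂ e₁ | inj₂ e₂ = true≢false (proj₁ (∧⁻ {subtreeᵇ p v} e₂)) (not⁻ (proj₂ (∧⁻ {not (R v)} e₁)))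

    R∩T₁⊆a : ∀ x → (R x ∧ T₁ x) ≡ true → x ≡ a
    R∩T₁⊆a x h with ∧⁻ {R x} h
    ... | x∈R , x∈T₁ with ∨⁻ {eqᵇ x a} x∈T₁
    ... | inj₁ e = eqᵇ-sound e
    ... | inj₂ e = ⊥-elim (true≢false x∈R (not⁻ (proj₁ (∧⁻ {not (R x)} e))))

    R∩T₂⊆p : ∀ x → (R x ∧ T₂ x) ≡ true → x ≡ p
    R∩T₂⊆p x h with ∧⁻ {R x} h
    ... | x∈R , x∈T₂ with ∨⁻ {eqᵇ x p} x∈T₂
    ... | inj₁ e = eqᵇ-sound e
    ... | inj₂ e = ⊥-elim (true≢false x∈R (not⁻ (proj₂ (∧⁻ {subtreeᵇ p x} e))))

  two-ended→split : (c : TwoEnded) → ∀ M → count (TwoEnded.R c) ≤ M → Split M (mass (TwoEnded.R c))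
  two-ended→split c M R≤M = tabulate R , tabulate T₁ , tabulate T₂ ,
      upward-closed-connected R a a∈R R-below R-upward ,
      upward-closed-connected T₁ root root∈T₁ (λ x _ → ≼-root x) T₁-upward ,
      upward-closed-connected T₂ p p∈T₂ T₂-below T₂-upward ,
      covers ,
      subst (_≤ M) (sym (∣tabulate∣ R)) R≤M ,
      ≤-reflexive (sym (∣tabulate∩∣ R L)) ,
      disjoint ,
      trans (∣tabulate∩tabulate∣ R T₁) (count-one _ a (cong₂ _∧_ a∈R a∈T₁) R∩T₁⊆a) ,
      trans (∣tabulate∩tabulate∣ R T₂) (count-one _ p (cong₂ _∧_ p∈R p∈T₂) R∩T₂⊆p)
    where
      open TwoEnded c
      open Complement c

  record Region (t : Fin n) : Set where
    field
      R : Fin n → Bool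
      openTop : Bool
      hole : Maybe (Fin n)
      top∈R : R t ≡ true
      R-below : ∀ x → R x ≡ true → x ≼ t
      R-upward : ∀ x → R x ≡ true → x ≢ t → R (parent x) ≡ true
      R-exits : ∀ x → R x ≡ false → R (parent x) ≡ true → x ≢ root →
                (parent x ≡ t × openTop ≡ true) ⊎ (hole ≡ just (parent x))
      hole∈R : ∀ p → hole ≡ just p → R p ≡ true × p ≢ t

  region→two-ended : ∀ {t} (g : Region t) p → Region.R g p ≡ true → p ≢ t →
                     (∀ q → Region.hole g ≡ just q → q ≡ p) → TwoEnded
  region→two-ended {t} g p p∈R p≢t hole≡p = record
    { a = t ; p = p ; R = R ; a∈R = top∈R ; p∈R = p∈R ; p≢a = p≢t
    ; R-below = R-below ; R-upward = R-upward ; R-exits = exits }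
    where
      open Region g
      exits : ∀ x → R x ≡ false → R (parent x) ≡ true → x ≢ root → parent x ≡ t ⊎ parent x ≡ p
      exits x x∉R px∈R x≢root with R-exits x x∉R px∈R x≢root
      ... | inj₁ (e , _) = inj₁ e
      ... | inj₂ e = inj₂ (hole≡p (parent x) e)

  edgePiece : ∀ p → p ≢ root → TwoEnded
  edgePiece p p≢root = record
    { a = parent p ; p = p ; R = R ; a∈R = ∨-introˡ (eqᵇ-refl (parent p)) ; p∈R = ∨-introʳ (eqᵇ-refl p)
    ; p≢a = p≢parent ; R-below = below ; R-upward = upward ; R-exits = exits }
    where
      R : Fin n → Bool
      R x = eqᵇ x (parent p) ∨ eqᵇ x p
      p≢parent : p ≢ parent p
      p≢parent e = parent⋠ p≢root (subst (_≼ p) e (≼-refl p))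
      below : ∀ x → R x ≡ true → x ≼ parent p
      below x h with ∨⁻ {eqᵇ x (parent p)} h
      ... | inj₁ e rewrite eqᵇ-sound e = ≼-refl (parent p)
      ... | inj₂ e rewrite eqᵇ-sound e = ≼-unparent (≼-refl (parent p)) p≢root
      upward : ∀ x → R x ≡ true → x ≢ parent p → R (parent x) ≡ true
      upward x h x≢pp with ∨⁻ {eqᵇ x (parent p)} h
      ... | inj₁ e = ⊥-elim (x≢pp (eqᵇ-sound e))
      ... | inj₂ e rewrite eqᵇ-sound e = ∨-introˡ (eqᵇ-refl (parent p))
      exits : ∀ x → R x ≡ false → R (parent x) ≡ true → x ≢ root → parent x ≡ parent p ⊎ parent x ≡ p
      exits x _ h _ with ∨⁻ {eqᵇ (parent x) (parent p)} h
      ... | inj₁ e = inj₁ (eqᵇ-sound e)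
      ... | inj₂ e = inj₂ (eqᵇ-sound e)

  edgePiece-size : ∀ p p≢root → count (TwoEnded.R (edgePiece p p≢root)) ≤ 2
  edgePiece-size p p≢root = ≤-trans (count-∪ (λ x → eqᵇ x (parent p)) (λ x → eqᵇ x p)) (≤-reflexive (cong₂ _+_
    (count-one _ (parent p) (eqᵇ-refl (parent p)) (λ x → eqᵇ-sound)) (count-one _ p (eqᵇ-refl p) (λ x → eqᵇ-sound))))

  edge-through : ∀ t → (∃ λ x → x ≢ root) → Σ (Fin n) λ p → Σ (p ≢ root) λ p≢root → t ≡ p ⊎ t ≡ parent p
  edge-through t (x , x≢root) with t ≟ root
  ... | no t≢root = t , t≢root , inj₁ refl
  ... | yes refl = c , c≢root , inj₂ (sym (depth≡0⇒root (parent c) (trans (depth-parent∸ c) (cong (_∸ 1) depth-c))))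
    where
      c = ancestor (depth x ∸ 1) x
      depth-c : depth c ≡ 1
      depth-c = trans (depth-ancestor (depth x ∸ 1) x) (m∸[m∸n]≡n (subst (1 ≤_) (sym (depth-parent x x≢root)) (s≤s z≤n)))
      c≢root : c ≢ root
      c≢root e with trans (sym depth-c) (trans (cong depth e) depth-root)
      ... | ()

  -- Every region with at most M ≥ 2 vertices yields a solution at least as heavy:
  -- it is two-ended (with its hole, or any second vertex, as p), or else it is
  -- the single vertex t, contained in a two-ended edge piece.
  region→split : ∀ {t} (g : Region t) M → 2 ≤ M → count (Region.R g) ≤ M → (∃ λ x → x ≢ root) →
                 Split M (mass (Region.R g))
  region→split {t} g M 2≤M R≤M nonroot with Region.hole g in hole≡
  ... | just p = two-ended→split (region→two-ended g p (proj₁ (hole∈R p hole≡)) (proj₂ (hole∈R p hole≡))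
                   (λ q e → just-injective (trans (sym e) hole≡))) M R≤M
    where open Region g
  ... | nothing with any? (λ x → Region.R g x Data.Bool.≟ true ×-dec ¬? (x ≟ t))
    where import Data.Bool
  ... | yes (p , p∈R , p≢t) = two-ended→split (region→two-ended g p p∈R p≢t
                                (λ q e → ⊥-elim (nothing≢just (trans (sym hole≡) e)))) M R≤M
  ... | no only-t with edge-through t nonroot
  ... | p , p≢root , t∈edge = Split-weaken (count-mono _ _ R⊆edge)
          (two-ended→split (edgePiece p p≢root) M (≤-trans (edgePiece-size p p≢root) 2≤M))
    where
      open Region g
      R⊆t : ∀ x → R x ≡ true → x ≡ t
      R⊆t x h with x ≟ t
      ... | yes e = e
      ... | no x≢t = ⊥-elim (only-t (x , h , x≢t))
      edge : Fin n → Bool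
      edge = TwoEnded.R (edgePiece p p≢root)
      t∈edge' : edge t ≡ true
      t∈edge' = [ (λ e → subst (λ z → edge z ≡ true) (sym e) (∨-introʳ {eqᵇ p (parent p)} (eqᵇ-refl p)))
                , (λ e → subst (λ z → edge z ≡ true) (sym e) (∨-introˡ (eqᵇ-refl (parent p)))) ]′ t∈edge
      R⊆edge : ∀ x → (R x ∧ inL x) ≡ true → (edge x ∧ inL x) ≡ true
      R⊆edge x h with ∧⁻ {R x} h
      ... | x∈R , x∈L rewrite R⊆t x x∈R = ∧-intro t∈edge' x∈L

-- Arithmetic bookkeeping for the scan, with parameters k (size unit), K
-- (number of affordable pieces) and W (= |L|); holes are elements of A.
module Bookkeeping {A : Set} (k K W : ℕ) where

  open import Data.Nat
  open import Data.Nat.Properties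
  open import Data.Bool using (Bool; true; false)
  open import Data.Maybe using (Maybe; just; nothing)
  open import Data.Empty using (⊥)
  open import Relation.Binary.PropositionalEquality
  open import Algebra.Properties.CommutativeSemigroup +-commutativeSemigroup using (interchange)
  open import Data.Nat.Tactic.RingSolver using (solve-∀)
  open ≤-Reasoning

  -- Covered m m' N: mass m is accounted for by mass m' together with N closed
  -- pieces of mass below W / K each.
  Covered : ℕ → ℕ → ℕ → Set
  Covered m m' N = K * m ≤ K * m' + N * W

  covered-refl : ∀ m → Covered m m 0
  covered-refl m = m≤m+n (K * m) 0

  covered-mono : ∀ {m₁ m m' m₂} N → m₁ ≤ m → m' ≤ m₂ → Covered m m' N → Covered m₁ m₂ N
  covered-mono {m₁} {m} {m'} {m₂} N m₁≤m m'≤m₂ cov = begin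
    K * m₁ ≤⟨ *-monoʳ-≤ K m₁≤m ⟩
    K * m ≤⟨ cov ⟩
    K * m' + N * W ≤⟨ +-monoˡ-≤ (N * W) (*-monoʳ-≤ K m'≤m₂) ⟩
    K * m₂ + N * W ∎

  covered-+ : ∀ m₁ m₁' N₁ m₂ m₂' N₂ → Covered m₁ m₁' N₁ → Covered m₂ m₂' N₂ →
              Covered (m₁ + m₂) (m₁' + m₂') (N₁ + N₂)
  covered-+ m₁ m₁' N₁ m₂ m₂' N₂ cov₁ cov₂ = begin
    K * (m₁ + m₂) ≡⟨ *-distribˡ-+ K m₁ m₂ ⟩
    K * m₁ + K * m₂ ≤⟨ +-mono-≤ cov₁ cov₂ ⟩
    (K * m₁' + N₁ * W) + (K * m₂' + N₂ * W) ≡⟨ interchange (K * m₁') (N₁ * W) (K * m₂') (N₂ * W) ⟩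
    (K * m₁' + K * m₂') + (N₁ * W + N₂ * W) ≡⟨ sym (cong₂ _+_ (*-distribˡ-+ K m₁' m₂') (*-distribʳ-+ W N₁ N₂)) ⟩
    K * (m₁' + m₂') + (N₁ + N₂) * W ∎

  covered-close : ∀ m m' c N → suc (K * c) ≤ W → Covered m (m' + c) N → Covered m m' (suc N)
  covered-close m m' c N light cov = begin
    K * m ≤⟨ cov ⟩
    K * (m' + c) + N * W ≡⟨ cong (_+ N * W) (*-distribˡ-+ K m' c) ⟩
    K * m' + K * c + N * W ≤⟨ +-monoˡ-≤ (N * W) (+-monoʳ-≤ (K * m') (<⇒≤ light)) ⟩
    K * m' + W + N * W ≡⟨ +-assoc (K * m') W (N * W) ⟩
    K * m' + suc N * W ∎

  cover-impossible : ∀ m N → Covered W m N → suc (K * m) ≤ W → suc N ≤ K → ⊥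
  cover-impossible m N cov light few = <-irrefl refl (begin-strict
    K * W ≤⟨ cov ⟩
    K * m + N * W <⟨ +-monoˡ-< (N * W) light ⟩
    W + N * W ≡⟨⟩
    suc N * W ≤⟨ *-monoˡ-≤ W few ⟩
    K * W ∎)

  covered-absorb : ∀ ms mu md mkg mO X → ms ≤ mu + md → Covered md mkg X → mu + mkg ≤ mO → Covered ms mO X
  covered-absorb ms mu md mkg mO X h₁ h₂ h₃ =
    covered-mono X h₁ h₃ (covered-+ mu mu 0 md mkg X (covered-refl mu) h₂)

  covered-merge : ∀ md' md ms mkg mo mnew X Y N → md' ≤ md + ms → Covered md mkg X → Covered ms mo Y →
                  mkg + mo ≤ mnew → N ≡ X + Y → Covered md' mnew N
  covered-merge md' md ms mkg mo mnew X Y N h₁ h₂ h₃ h₄ refl =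
    covered-mono (X + Y) h₁ h₄ (covered-+ md mkg X ms mo Y h₂ h₃)

  covered-close-child : ∀ md' md ms mkg mo X Y N → md' ≤ md + ms → Covered md mkg X → Covered ms mo Y →
                        suc (K * mo) ≤ W → N ≡ suc (X + Y) → Covered md' mkg N
  covered-close-child md' md ms mkg mo X Y N h₁ h₂ h₃ h₄ refl =
    covered-mono (suc (X + Y)) h₁ ≤-refl (covered-close (md + ms) mkg mo (X + Y) h₄ (covered-+ md mkg X ms mo Y h₂ h₃))

  covered-close-fan : ∀ md' md ms mkg mo mK mF mnew X Y N → md' ≤ md + ms → Covered md mkg X → Covered ms mo Y →
                      mkg + mo ≤ mK + mF → suc (K * mF) ≤ W → mK ≤ mnew → N ≡ suc (X + Y) → Covered md' mnew N
  covered-close-fan md' md ms mkg mo mK mF mnew X Y N h₁ h₂ h₃ h₄ h₅ h₆ refl =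
    covered-mono (suc (X + Y)) h₁ h₆ (covered-close (md + ms) mK mF (X + Y)
      h₅ (covered-mono (X + Y) ≤-refl h₄ (covered-+ md mkg X ms mo Y h₂ h₃)))

  -- Potential weight of the open top and of the hole of the current piece.
  wt : Bool → Maybe A → ℕ
  wt false nothing = 0
  wt true nothing = 2
  wt false (just _) = 2
  wt true (just _) = 3

  wt-open : ∀ (openTop : Bool) (hole : Maybe A) → wt true hole ≤ wt openTop hole + 2
  wt-open false nothing = ≤-refl
  wt-open true nothing = s≤s (s≤s z≤n)
  wt-open false (just _) = s≤s (s≤s (s≤s z≤n))
  wt-open true (just _) = s≤s (s≤s (s≤s z≤n))

  wt-hole : ∀ openTop (q : A) → wt openTop (just q) ≤ wt openTop nothing + 2
  wt-hole false q = ≤-refl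
  wt-hole true q = s≤s (s≤s (s≤s z≤n))

  -- A second hole (or a hole next to an open top) pays for a forced closure.
  wt-second-hole : ∀ openTop (p : A) tc (dc : Maybe A) → 2 ≤ wt tc dc →
                   1 + wt true (just p) ≤ wt openTop (just p) + wt tc dc
  wt-second-hole false p tc dc h = +-monoʳ-≤ 2 h
  wt-second-hole true p tc dc h = ≤-trans (+-monoʳ-≤ 2 h) (+-monoˡ-≤ (wt tc dc) (n≤1+n 2))

  wt-open-hole : ∀ openTop hole → 1 + wt true hole ≤ wt openTop hole + 3
  wt-open-hole false nothing = s≤s (s≤s (s≤s z≤n))
  wt-open-hole true nothing = s≤s (s≤s (s≤s z≤n))
  wt-open-hole openTop (just p) = wt-second-hole openTop p true (just p) (s≤s (s≤s z≤n))

  -- The potential NF + wt ≤ 2 NB is additive ...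
  potential-+ : ∀ NF nf w NB nb w' → NF + w ≤ 2 * NB → nf + w' ≤ 2 * nb → (NF + nf) + w ≤ 2 * (NB + nb)
  potential-+ NF nf w NB nb w' h₁ h₂ = begin
    (NF + nf) + w ≡⟨ +-assoc NF nf w ⟩
    NF + (nf + w) ≡⟨ cong (NF +_) (+-comm nf w) ⟩
    NF + (w + nf) ≡⟨ sym (+-assoc NF w nf) ⟩
    (NF + w) + nf ≤⟨ +-mono-≤ h₁ (≤-trans (m≤m+n nf w') h₂) ⟩
    2 * NB + 2 * nb ≡⟨ sym (*-distribˡ-+ 2 NB nb) ⟩
    2 * (NB + nb) ∎

  -- ... it may trade weight for e forced closures ...
  potential-trade : ∀ NF NB nf nb a b e w → NF + a ≤ 2 * NB → nf + b ≤ 2 * nb → e + w ≤ a + b →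
                    (NF + nf + e) + w ≤ 2 * (NB + nb)
  potential-trade NF NB nf nb a b e w h₁ h₂ h₃ = begin
    (NF + nf + e) + w ≡⟨ +-assoc (NF + nf) e w ⟩
    (NF + nf) + (e + w) ≤⟨ +-monoʳ-≤ (NF + nf) h₃ ⟩
    (NF + nf) + (a + b) ≡⟨ interchange NF nf a b ⟩
    (NF + a) + (nf + b) ≤⟨ +-mono-≤ h₁ h₂ ⟩
    2 * NB + 2 * nb ≡⟨ sym (*-distribˡ-+ 2 NB nb) ⟩
    2 * (NB + nb) ∎

  -- ... and a big closed piece pays for opening the top.
  potential-big : ∀ openTop (hole : Maybe A) NF nf NB nb w' → NF + wt openTop hole ≤ 2 * NB →
                  nf + w' ≤ 2 * nb → (NF + nf) + wt true hole ≤ 2 * (NB + nb + 1)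
  potential-big openTop hole NF nf NB nb w' pot potc = begin
    (NF + nf) + wt true hole ≤⟨ +-monoʳ-≤ (NF + nf) (wt-open openTop hole) ⟩
    (NF + nf) + (wt openTop hole + 2) ≡⟨ sym (+-assoc (NF + nf) (wt openTop hole) 2) ⟩
    (NF + nf) + wt openTop hole + 2 ≤⟨ +-monoˡ-≤ 2 (potential-+ NF nf (wt openTop hole) NB nb w' pot potc) ⟩
    2 * (NB + nb) + 2 ≡⟨ sym (*-distribˡ-+ 2 (NB + nb) 1) ⟩
    2 * (NB + nb + 1) ∎

  count-big : ∀ a b c d → (a + b + 1) + (c + d) ≡ suc ((a + c) + (b + d))
  count-big = solve-∀

  count-forced : ∀ a b c d → (a + b) + (c + d + 1) ≡ suc ((a + c) + (b + d))
  count-forced = solve-∀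

  -- A big closed piece owns at least k vertices.
  owned-big : ∀ NB nb m → k ≤ m → k * (NB + nb + 1) ≤ (k * NB + k * nb) + m
  owned-big NB nb m h = begin
    k * (NB + nb + 1) ≡⟨ *-distribˡ-+ k (NB + nb) 1 ⟩
    k * (NB + nb) + k * 1 ≡⟨ cong₂ _+_ (*-distribˡ-+ k NB nb) (*-identityʳ k) ⟩
    (k * NB + k * nb) + k ≤⟨ +-monoʳ-≤ (k * NB + k * nb) h ⟩
    (k * NB + k * nb) + m ∎

-- The scan either finds a region with
-- fewer than 2k vertices and K · mass ≥ W (Found), or it closes pieces of mass
-- below W / K and accounts for the vertices they owned.
module Decomposition {n : ℕ} {E : Fin n → Fin n → Set} (E-sym : ∀ u v → E u v → E v u)
                     (ρ : RootedTrees.Rooting E) (L : Subset n) (k K W : ℕ) (k≥1 : 1 ≤ k) where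

  open import Data.Nat hiding (_≟_)
  open import Data.Nat.Properties hiding (_≟_)
  open import Data.Bool using (Bool; true; false; _∨_; _∧_; not)
  open import Data.Fin using (_≟_; toℕ; fromℕ<)
  open import Data.Fin.Properties using (toℕ-injective; toℕ<n; toℕ-fromℕ<)
  open import Data.Empty using (⊥; ⊥-elim)
  open import Data.Product using (Σ; ∃; _×_; _,_; proj₁; proj₂)
  open import Data.Maybe using (Maybe; just; nothing)
  open import Data.Maybe.Properties using (just-injective)
  open import Data.Sum using (_⊎_; inj₁; inj₂; [_,_]′)
  open import Relation.Nullary using (¬_; yes; no)
  open import Relation.Binary.PropositionalEquality
  open import Algebra.Properties.CommutativeSemigroup +-commutativeSemigroup using (interchange; xy∙z≈xz∙y)
  open import Data.Nat.Tactic.RingSolver using (solve-∀)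
  open Booleans
  open Counting
  open Pieces E-sym ρ L public
  open Bookkeeping {Fin n} k K W

  -- The children of u are scanned in the order of Fin n.  Scanned u i x: x lies
  -- strictly below u, under a child of u with index below i.
  Scanned : Fin n → ℕ → Fin n → Bool
  Scanned u i x = subtreeᵇ u x ∧ (not (eqᵇ x u) ∧ (toℕ (childToward u x) <ᵇ i))

  Scanned⁻ : ∀ {u i x} → Scanned u i x ≡ true → x ≼ u × x ≢ u × toℕ (childToward u x) < i
  Scanned⁻ {u} {i} {x} h with ∧⁻ {subtreeᵇ u x} h
  ... | h1 , h2 with ∧⁻ {not (eqᵇ x u)} h2
  ... | h3 , h4 = subtreeᵇ-sound u x h1 , eqᵇ-false (not⁻ h3) , <ᵇ-sound _ _ h4

  Scanned⁺ : ∀ {u i x} → x ≼ u → x ≢ u → toℕ (childToward u x) < i → Scanned u i x ≡ true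
  Scanned⁺ {u} {i} {x} h1 h2 h3 = ∧-intro (subtreeᵇ-complete u x h1) (∧-intro (not-intro (eqᵇ-≢ h2)) (<ᵇ-complete h3))

  Scanned-step : ∀ {u i x} → Scanned u i x ≡ true → Scanned u (suc i) x ≡ true
  Scanned-step h with Scanned⁻ h
  ... | a , b , c = Scanned⁺ a b (m≤n⇒m≤1+n c)

  Scanned-new : ∀ {u c i x} → Child u c → toℕ c ≡ i → x ≼ c → Scanned u (suc i) x ≡ true
  Scanned-new {u} {c} {i} {x} ch ci h with child-subtree ch h
  ... | a , b = Scanned⁺ a b (≤-reflexive (cong suc (trans (cong toℕ (childToward-unique ch h)) ci)))

  Scanned-fresh : ∀ {u c i x} → Child u c → toℕ c ≡ i → x ≼ c → Scanned u i x ≡ false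
  Scanned-fresh {u} {c} {i} {x} ch ci h with Scanned u i x in e
  ... | false = refl
  ... | true with Scanned⁻ e
  ... | _ , _ , lt = ⊥-elim (<-irrefl (trans (cong toℕ (childToward-unique ch h)) ci) lt)

  Scanned-split : ∀ {u c i x} → toℕ c ≡ i → Scanned u (suc i) x ≡ true → Scanned u i x ≡ true ⊎ (Child u c × x ≼ c)
  Scanned-split {u} {c} {i} {x} ci h with Scanned⁻ h
  ... | a , b , lt with toℕ (childToward u x) Data.Nat.≟ i
  ...   | yes e = inj₂ (subst (Child u) cc (proj₁ (childToward-spec a b)) , subst (x ≼_) cc (proj₂ (childToward-spec a b)))
    where cc : childToward u x ≡ c
          cc = toℕ-injective (trans e (sym ci))
  ...   | no ne = inj₁ (Scanned⁺ a b (≤∧≢⇒< (s≤s⁻¹ lt) ne))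

  Scanned-all : ∀ {u x} → x ≼ u → x ≢ u → Scanned u n x ≡ true
  Scanned-all a b = Scanned⁺ a b (toℕ<n _)

  Scanned-none : ∀ {u x} → Scanned u 0 x ≡ false
  Scanned-none {u} {x} with Scanned u 0 x in e
  ... | false = refl
  ... | true with Scanned⁻ {u} {0} {x} e
  ... | _ , _ , ()

  Scanned-skip : ∀ {u c i} → ¬ Child u c → toℕ c ≡ i → ∀ x → Scanned u (suc i) x ≡ Scanned u i x
  Scanned-skip {u} {c} {i} nc ci x with Scanned u (suc i) x in e1 | Scanned u i x in e2
  ... | false | false = refl
  ... | true | true = refl
  ... | false | true = ⊥-elim (true≢false (Scanned-step e2) e1)
  ... | true | false with Scanned-split ci e1
  ... | inj₁ e = ⊥-elim (true≢false e e2)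
  ... | inj₂ (ch , _) = ⊥-elim (nc ch)

  Scanned-nonroot : ∀ {u i x} → Scanned u i x ≡ true → x ≢ root
  Scanned-nonroot {u} {i} {x} h with Scanned⁻ {u} {i} {x} h
  ... | a , b , _ = λ e → b (≼-antisym a (subst (u ≼_) (sym e) (≼-root u)))

  Found : Set
  Found = Σ (Fin n) λ t → Σ (Region t) λ g → suc (count (Region.R g)) ≤ k + k × W ≤ K * mass (Region.R g)

  -- The outcome of scanning the subtree of u: its open piece, of fewer than 2k
  -- vertices, and nb + nf closed pieces, each of mass below W / K; the nb
  -- "big" ones own k vertices each, the nf "forced" ones are paid for by the
  -- potential.
  record Outcome (u : Fin n) : Set where
    field
      piece : Region u
      nb nf : ℕ
      small : suc (count (Region.R piece)) ≤ k + k
      potential : nf + wt (Region.openTop piece) (Region.hole piece) ≤ 2 * nb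
      owned : k * nb ≤ count (λ x → subtreeᵇ u x ∧ not (Region.R piece x))
      subtree-mass : K * mass (subtreeᵇ u) ≤ K * mass (Region.R piece) + (nb + nf) * W

  -- The state while scanning the children of u: the scanned part is covered by
  -- Kept (the open piece of one child, with a hole), Group (open pieces of
  -- children without hole or open top, together of fewer than k vertices) and
  -- NB + NF closed pieces.  openTop records that some piece hanging from u was
  -- closed.  Every edge leaving Kept ∪ Group ∪ {u} downwards leaves from u (if
  -- openTop) or from the hole of Kept.
  record State (u : Fin n) (i : ℕ) : Set where
    field
      Kept Group : Fin n → Bool
      openTop : Bool
      keptHole : Maybe (Fin n)
      NB NF : ℕ
      Kept-scanned : ∀ x → Kept x ≡ true → Scanned u i x ≡ true
      Group-scanned : ∀ x → Group x ≡ true → Scanned u i x ≡ true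
      Kept-Group-disjoint : ∀ x → Kept x ≡ true → Group x ≡ true → ⊥
      Kept-upward : ∀ x → Kept x ≡ true → Kept (parent x) ≡ true ⊎ parent x ≡ u
      Group-upward : ∀ x → Group x ≡ true → Group (parent x) ≡ true ⊎ parent x ≡ u
      exits : ∀ x → Scanned u i x ≡ true → Kept x ≡ false → Group x ≡ false →
            (parent x ≡ u ⊎ Kept (parent x) ≡ true ⊎ Group (parent x) ≡ true) →
            (parent x ≡ u × openTop ≡ true) ⊎ keptHole ≡ just (parent x)
      Group-closed : ∀ x → Group x ≡ false → Group (parent x) ≡ true → x ≢ root → ⊥
      keptHole∈Kept : ∀ p → keptHole ≡ just p → Kept p ≡ true
      no-hole-no-Kept : keptHole ≡ nothing → ∀ x → Kept x ≡ false
      Kept-small : suc (count Kept) ≤ k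
      Group-small : suc (count Group) ≤ k
      potential : NF + wt openTop keptHole ≤ 2 * NB
      owned : k * NB ≤ count (λ x → Scanned u i x ∧ not (Kept x ∨ Group x))
      scanned-mass : K * mass (Scanned u i) ≤ K * mass (λ x → Kept x ∨ Group x) + (NB + NF) * W

  ∅ : Fin n → Bool
  ∅ _ = false

  start : ∀ u → State u 0
  start u = record
    { Kept = ∅ ; Group = ∅ ; openTop = false ; keptHole = nothing ; NB = 0 ; NF = 0
    ; Kept-scanned = λ _ () ; Group-scanned = λ _ () ; Kept-Group-disjoint = λ _ () ; Kept-upward = λ _ () ; Group-upward = λ _ ()
    ; exits = λ x d → ⊥-elim (true≢false d (Scanned-none {u} {x}))
    ; Group-closed = λ _ _ () ; keptHole∈Kept = λ _ () ; no-hole-no-Kept = λ _ _ → refl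
    ; Kept-small = e0 ; Group-small = e0 ; potential = z≤n ; owned = subst (_≤ count (λ x → Scanned u 0 x ∧ not (∅ x ∨ ∅ x))) (sym (*-zeroʳ k)) z≤n
    ; scanned-mass = subst (_≤ K * mass (λ x → ∅ x ∨ ∅ x) + (0 + 0) * W) (sym (trans (cong (K *_) (mass-none (Scanned u 0) (λ x → Scanned-none {u} {x}))) (*-zeroʳ K))) z≤n }
    where e0 : suc (count ∅) ≤ k
          e0 = subst (λ z → suc z ≤ k) (sym (count-none ∅ (λ _ → refl))) k≥1

  finish : ∀ u → State u n → Outcome u
  finish u st = record
    { piece = piece ; nb = NB ; nf = NF ; small = small ; potential = potential ; owned = owned' ; subtree-mass = subtree-mass }
    where
      open State st
      O : Fin n → Bool
      O x = eqᵇ x u ∨ (Kept x ∨ Group x)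
      Kept∨Group-scanned : ∀ x → (Kept x ∨ Group x) ≡ true → Scanned u n x ≡ true
      Kept∨Group-scanned x h = [ Kept-scanned x , Group-scanned x ]′ (∨⁻ h)
      O-below : ∀ x → O x ≡ true → x ≼ u
      O-below x h with ∨⁻ {eqᵇ x u} h
      ... | inj₁ e rewrite eqᵇ-sound e = ≼-refl u
      ... | inj₂ e = proj₁ (Scanned⁻ {u} {n} {x} (Kept∨Group-scanned x e))
      O-upward : ∀ x → O x ≡ true → x ≢ u → O (parent x) ≡ true
      O-upward x h ne with ∨⁻ {eqᵇ x u} h
      ... | inj₁ e = ⊥-elim (ne (eqᵇ-sound e))
      ... | inj₂ e with ∨⁻ {Kept x} e
      ... | inj₁ kx = [ (λ k' → ∨-introʳ {eqᵇ (parent x) u} (∨-introˡ k')) , (λ e' → ∨-introˡ (subst (λ z → eqᵇ z u ≡ true) (sym e') (eqᵇ-refl u))) ]′ (Kept-upward x kx)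
      ... | inj₂ gx = [ (λ g' → ∨-introʳ {eqᵇ (parent x) u} (∨-introʳ {Kept (parent x)} g')) , (λ e' → ∨-introˡ (subst (λ z → eqᵇ z u ≡ true) (sym e') (eqᵇ-refl u))) ]′ (Group-upward x gx)
      O-exits : ∀ x → O x ≡ false → O (parent x) ≡ true → x ≢ root → (parent x ≡ u × openTop ≡ true) ⊎ keptHole ≡ just (parent x)
      O-exits x h1 h2 xr with ∨-false⁻ {eqᵇ x u} h1
      ... | ex , kg with ∨-false⁻ {Kept x} kg
      ... | kx , gx = exits x dx kx gx where'
        where
          dx : Scanned u n x ≡ true
          dx = Scanned-all (≼-unparent (O-below (parent x) h2) xr) (eqᵇ-false ex)
          where' : parent x ≡ u ⊎ Kept (parent x) ≡ true ⊎ Group (parent x) ≡ true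
          where' with ∨⁻ {eqᵇ (parent x) u} h2
          ... | inj₁ e = inj₁ (eqᵇ-sound e)
          ... | inj₂ e = inj₂ (∨⁻ e)
      piece : Region u
      piece = record { R = O ; openTop = openTop ; hole = keptHole ; top∈R = ∨-introˡ (eqᵇ-refl u) ; R-below = O-below ; R-upward = O-upward ; R-exits = O-exits
                   ; hole∈R = λ p e → ∨-introʳ {eqᵇ p u} (∨-introˡ (keptHole∈Kept p e)) , proj₁ (proj₂ (Scanned⁻ {u} {n} {p} (Kept-scanned p (keptHole∈Kept p e)))) }
      small : suc (count O) ≤ k + k
      small = begin
        suc (count O) ≤⟨ s≤s (count-∪ (λ x → eqᵇ x u) (λ x → Kept x ∨ Group x)) ⟩
        suc (count (λ x → eqᵇ x u) + count (λ x → Kept x ∨ Group x)) ≡⟨ cong (λ z → suc (z + count (λ x → Kept x ∨ Group x))) (count-one _ u (eqᵇ-refl u) (λ x → eqᵇ-sound)) ⟩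
        suc (suc (count (λ x → Kept x ∨ Group x))) ≤⟨ s≤s (s≤s (count-∪ Kept Group)) ⟩
        suc (suc (count Kept + count Group)) ≡⟨ cong suc (sym (+-suc (count Kept) (count Group))) ⟩
        suc (count Kept) + suc (count Group) ≤⟨ +-mono-≤ Kept-small Group-small ⟩
        k + k ∎
        where open ≤-Reasoning
      owned' : k * NB ≤ count (λ x → subtreeᵇ u x ∧ not (O x))
      owned' = ≤-trans owned (count-mono _ _ λ x h → let (d , nk) = ∧⁻ {Scanned u n x} h in
               ∧-intro (proj₁ (∧⁻ {subtreeᵇ u x} d)) (not-intro (∨-false (eqᵇ-≢ (proj₁ (proj₂ (Scanned⁻ {u} {n} {x} d)))) (not⁻ nk))))
      subtree-mass : K * mass (subtreeᵇ u) ≤ K * mass O + (NB + NF) * W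
      subtree-mass = covered-absorb _ _ _ _ _ (NB + NF)
        (mass-∪ (λ x → eqᵇ x u) (Scanned u n) (subtreeᵇ u) (λ x h → sp x h))
        scanned-mass
        (mass-split (λ x → eqᵇ x u) (λ x → Kept x ∨ Group x) O
           (λ x e1 e2 → proj₁ (proj₂ (Scanned⁻ {u} {n} {x} (Kept∨Group-scanned x e2))) (eqᵇ-sound e1)) (λ x e → ∨-introˡ e) (λ x e → ∨-introʳ {eqᵇ x u} e))
        where
          sp : ∀ x → subtreeᵇ u x ≡ true → eqᵇ x u ≡ true ⊎ Scanned u n x ≡ true
          sp x h with bool-cases (eqᵇ x u)
          ... | inj₂ e = inj₁ e
          ... | inj₁ e = inj₂ (Scanned-all (subtreeᵇ-sound u x h) (eqᵇ-false e))

  module Step (u c : Fin n) (i : ℕ) (ch : Child u c) (ci : toℕ c ≡ i) where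

    new : ∀ {x} → x ≼ c → Scanned u (suc i) x ≡ true
    new = Scanned-new ch ci
    fresh : ∀ {x} → x ≼ c → Scanned u i x ≡ false
    fresh = Scanned-fresh ch ci
    split : ∀ {x} → Scanned u (suc i) x ≡ true → Scanned u i x ≡ true ⊎ (Child u c × x ≼ c)
    split = Scanned-split ci
    old⇒parent⋠c : ∀ {x} → Scanned u i x ≡ true → parent x ≼ c → ⊥
    old⇒parent⋠c {x} d h = true≢false d (fresh (≼-unparent h (Scanned-nonroot {u} {i} {x} d)))
    parent-c : parent c ≡ u
    parent-c = proj₂ ch
    c≢root : c ≢ root
    c≢root = proj₁ ch

    module ChildStep (st : State u i) (ic : Outcome c) where
      open State st public
      open Outcome ic public using (nb; nf; subtree-mass)
        renaming (piece to childPiece; owned to owned-c; potential to potential-c)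
      open Region childPiece public using ()
        renaming (R to Rc; top∈R to c∈Rc; R-below to Rc-below; R-upward to Rc-upward; R-exits to Rc-exits)

      Rc-fresh : ∀ {x} → Scanned u i x ≡ true → Rc x ≡ false
      Rc-fresh {x} d with Rc x in e
      ... | false = refl
      ... | true = ⊥-elim (true≢false d (fresh (Rc-below x e)))

      Kept-fresh : ∀ {x} → x ≼ c → Kept x ≡ false
      Kept-fresh {x} h with Kept x in e
      ... | false = refl
      ... | true = ⊥-elim (true≢false (Kept-scanned x e) (fresh h))

      Group-fresh : ∀ {x} → x ≼ c → Group x ≡ false
      Group-fresh {x} h with Group x in e
      ... | false = refl
      ... | true = ⊥-elim (true≢false (Group-scanned x e) (fresh h))

      Kept∨Group-fresh : ∀ {x} → x ≼ c → (Kept x ∨ Group x) ≡ false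
      Kept∨Group-fresh h = ∨-false (Kept-fresh h) (Group-fresh h)

      Group⇒¬Kept : ∀ {x} → Group x ≡ true → Kept x ≡ false
      Group⇒¬Kept {x} g with Kept x in e
      ... | true = ⊥-elim (Kept-Group-disjoint x e g)
      ... | false = refl

      scanned-mass-step : mass (Scanned u (suc i)) ≤ mass (Scanned u i) + mass (subtreeᵇ c)
      scanned-mass-step = mass-∪ (Scanned u i) (subtreeᵇ c) (Scanned u (suc i))
        λ x d → [ inj₁ , (λ p → inj₂ (subtreeᵇ-complete c x (proj₂ p))) ]′ (split d)

      sealed : Region.openTop childPiece ≡ false → Region.hole childPiece ≡ nothing →
               ∀ x → Rc x ≡ false → Rc (parent x) ≡ true → x ≼ c → ⊥
      sealed no-top no-hole x x∉Rc px∈Rc x≼c with Rc-exits x x∉Rc px∈Rc (≼-nonroot x≼c c≢root)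
      ... | inj₁ (_ , t) = true≢false t no-top
      ... | inj₂ e with trans (sym no-hole) e
      ... | ()

    close-child : (st : State u i) (ic : Outcome c) → (NB' NF' : ℕ) →
      NB' + NF' ≡ suc ((State.NB st + State.NF st) + (Outcome.nb ic + Outcome.nf ic)) →
      NF' + wt true (State.keptHole st) ≤ 2 * NB' →
      k * NB' ≤ (k * State.NB st + k * Outcome.nb ic) + count (Region.R (Outcome.piece ic)) →
      suc (K * mass (Region.R (Outcome.piece ic))) ≤ W → State u (suc i)
    close-child st ic NB' NF' counts potential' owned-bound light = record
      { Kept = Kept ; Group = Group ; openTop = true ; keptHole = keptHole ; NB = NB' ; NF = NF'
      ; Kept-scanned = λ x h → Scanned-step (Kept-scanned x h) ; Group-scanned = λ x h → Scanned-step (Group-scanned x h) ; Kept-Group-disjoint = Kept-Group-disjoint ; Kept-upward = Kept-upward ; Group-upward = Group-upward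
      ; exits = exits' ; Group-closed = Group-closed ; keptHole∈Kept = keptHole∈Kept ; no-hole-no-Kept = no-hole-no-Kept ; Kept-small = Kept-small ; Group-small = Group-small ; potential = potential'
      ; owned = owned' ; scanned-mass = scanned-mass' }
      where
        open ChildStep st ic
        exits' : ∀ x → Scanned u (suc i) x ≡ true → Kept x ≡ false → Group x ≡ false →
            (parent x ≡ u ⊎ Kept (parent x) ≡ true ⊎ Group (parent x) ≡ true) →
            (parent x ≡ u × true ≡ true) ⊎ keptHole ≡ just (parent x)
        exits' x d kx gx w with split d
        ... | inj₁ dx with exits x dx kx gx w
        ...   | inj₁ (e , _) = inj₁ (e , refl)
        ...   | inj₂ e = inj₂ e
        exits' x d kx gx (inj₁ e) | inj₂ _ = inj₁ (e , refl)
        exits' x d kx gx (inj₂ w) | inj₂ (_ , xc) with x ≟ c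
        ... | yes refl = inj₁ (parent-c , refl)
        ... | no ne = ⊥-elim (true≢false ([ Kept-scanned (parent x) , Group-scanned (parent x) ]′ w) (fresh (≼-parent xc ne)))
        A B C T' : Fin n → Bool
        A x = Scanned u i x ∧ not (Kept x ∨ Group x)
        B x = subtreeᵇ c x ∧ not (Rc x)
        C = Rc
        T' x = Scanned u (suc i) x ∧ not (Kept x ∨ Group x)
        bc : count B + count C ≤ count (subtreeᵇ c)
        bc = count-split B C (subtreeᵇ c) (λ x e1 e2 → true≢false e2 (not⁻ (proj₂ (∧⁻ {subtreeᵇ c x} e1))))
               (λ x e → proj₁ (∧⁻ {subtreeᵇ c x} e)) (λ x e → subtreeᵇ-complete c x (Rc-below x e))
        abc : count A + count (subtreeᵇ c) ≤ count T'
        abc = count-split A (subtreeᵇ c) T'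
               (λ x e1 e2 → true≢false (proj₁ (∧⁻ {Scanned u i x} e1)) (fresh (subtreeᵇ-sound c x e2)))
               (λ x e → let (d , nk) = ∧⁻ {Scanned u i x} e in ∧-intro (Scanned-step d) nk)
               (λ x e → ∧-intro (new (subtreeᵇ-sound c x e)) (not-intro (Kept∨Group-fresh (subtreeᵇ-sound c x e))))
        owned' : k * NB' ≤ count T'
        owned' = begin
          k * NB' ≤⟨ owned-bound ⟩
          (k * NB + k * nb) + count C ≤⟨ +-monoˡ-≤ (count C) (+-mono-≤ owned owned-c) ⟩
          (count A + count B) + count C ≡⟨ +-assoc (count A) (count B) (count C) ⟩
          count A + (count B + count C) ≤⟨ +-monoʳ-≤ (count A) bc ⟩
          count A + count (subtreeᵇ c) ≤⟨ abc ⟩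
          count T' ∎
          where open ≤-Reasoning
        scanned-mass' : K * mass (Scanned u (suc i)) ≤ K * mass (λ x → Kept x ∨ Group x) + (NB' + NF') * W
        scanned-mass' = covered-close-child _ _ _ _ _ (NB + NF) (nb + nf) (NB' + NF')
          scanned-mass-step
          scanned-mass subtree-mass light counts

    keep-child : (st : State u i) (ic : Outcome c) → State.keptHole st ≡ nothing →
      suc (count (Region.R (Outcome.piece ic))) ≤ k →
      (q : Fin n) → Region.R (Outcome.piece ic) q ≡ true →
      (∀ y → (y ≡ c × Region.openTop (Outcome.piece ic) ≡ true) ⊎ (Region.hole (Outcome.piece ic) ≡ just y) → y ≡ q) →
      (State.NF st + Outcome.nf ic) + wt (State.openTop st) (just q) ≤ 2 * (State.NB st + Outcome.nb ic) →
      State u (suc i)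
    keep-child st ic no-hole small-c q q∈Rc exit-q potential' = record
      { Kept = Rc ; Group = Group ; openTop = openTop ; keptHole = just q ; NB = NB + nb ; NF = NF + nf
      ; Kept-scanned = λ x h → new (Rc-below x h) ; Group-scanned = λ x h → Scanned-step (Group-scanned x h)
      ; Kept-Group-disjoint = λ x e1 e2 → true≢false (Group-scanned x e2) (fresh (Rc-below x e1))
      ; Kept-upward = Kept-upward' ; Group-upward = Group-upward ; exits = exits' ; Group-closed = Group-closed
      ; keptHole∈Kept = λ p e → subst (λ z → Rc z ≡ true) (just-injective e) q∈Rc
      ; no-hole-no-Kept = λ () ; Kept-small = small-c ; Group-small = Group-small ; potential = potential' ; owned = owned' ; scanned-mass = scanned-mass' }
      where
        open ChildStep st ic
        Kept-upward' : ∀ x → Rc x ≡ true → Rc (parent x) ≡ true ⊎ parent x ≡ u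
        Kept-upward' x h with x ≟ c
        ... | yes refl = inj₂ parent-c
        ... | no ne = inj₁ (Rc-upward x h ne)
        no-Kept : ∀ x → Kept x ≡ false
        no-Kept = no-hole-no-Kept no-hole
        exits' : ∀ x → Scanned u (suc i) x ≡ true → Rc x ≡ false → Group x ≡ false →
            (parent x ≡ u ⊎ Rc (parent x) ≡ true ⊎ Group (parent x) ≡ true) →
            (parent x ≡ u × openTop ≡ true) ⊎ just q ≡ just (parent x)
        exits' x d ox gx w with split d
        exits' x d ox gx (inj₂ (inj₁ o)) | inj₁ dx = ⊥-elim (old⇒parent⋠c dx (Rc-below (parent x) o))
        exits' x d ox gx (inj₁ e) | inj₁ dx with exits x dx (no-Kept x) gx (inj₁ e)
        ... | inj₁ p = inj₁ p
        ... | inj₂ e' = ⊥-elim (nothing≢just (trans (sym no-hole) e'))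
        exits' x d ox gx (inj₂ (inj₂ g)) | inj₁ dx with exits x dx (no-Kept x) gx (inj₂ (inj₂ g))
        ... | inj₁ p = inj₁ p
        ... | inj₂ e' = ⊥-elim (nothing≢just (trans (sym no-hole) e'))
        exits' x d ox gx w | inj₂ (_ , xc) = res w
          where
            xnc : x ≢ c
            xnc e = true≢false (subst (λ z → Rc z ≡ true) (sym e) c∈Rc) ox
            pc : parent x ≼ c
            pc = ≼-parent xc xnc
            res : (parent x ≡ u ⊎ Rc (parent x) ≡ true ⊎ Group (parent x) ≡ true) → (parent x ≡ u × openTop ≡ true) ⊎ just q ≡ just (parent x)
            res (inj₁ e) = ⊥-elim (parent⋠child ch (subst (_≼ c) e pc))
            res (inj₂ (inj₂ g)) = ⊥-elim (true≢false (Group-scanned (parent x) g) (fresh pc))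
            res (inj₂ (inj₁ o)) = inj₂ (cong just (sym (exit-q (parent x) (Rc-exits x ox o (≼-nonroot xc c≢root)))))
        A B T' : Fin n → Bool
        A x = Scanned u i x ∧ not (Kept x ∨ Group x)
        B x = subtreeᵇ c x ∧ not (Rc x)
        T' x = Scanned u (suc i) x ∧ not (Rc x ∨ Group x)
        owned' : k * (NB + nb) ≤ count T'
        owned' = begin
          k * (NB + nb) ≡⟨ *-distribˡ-+ k NB nb ⟩
          k * NB + k * nb ≤⟨ +-mono-≤ owned owned-c ⟩
          count A + count B ≤⟨ count-split A B T'
               (λ x e1 e2 → true≢false (proj₁ (∧⁻ {Scanned u i x} e1)) (fresh (subtreeᵇ-sound c x (proj₁ (∧⁻ {subtreeᵇ c x} e2)))))
               (λ x e → let (d , nk) = ∧⁻ {Scanned u i x} e in ∧-intro (Scanned-step d) (not-intro (∨-false (Rc-fresh d) (proj₂ (∨-false⁻ {Kept x} (not⁻ nk))))))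
               (λ x e → let (sc , nO) = ∧⁻ {subtreeᵇ c x} e in ∧-intro (new (subtreeᵇ-sound c x sc)) (not-intro (∨-false (not⁻ nO) (Group-fresh (subtreeᵇ-sound c x sc))))) ⟩
          count T' ∎
          where
            open ≤-Reasoning
        scanned-mass' : K * mass (Scanned u (suc i)) ≤ K * mass (λ x → Rc x ∨ Group x) + ((NB + nb) + (NF + nf)) * W
        scanned-mass' = covered-merge _ _ _ _ _ _ (NB + NF) (nb + nf) ((NB + nb) + (NF + nf))
          scanned-mass-step
          scanned-mass subtree-mass
          (≤-trans (+-monoˡ-≤ (mass Rc) (mass-mono (λ x → Kept x ∨ Group x) Group λ x e → [ (λ kx → ⊥-elim (true≢false kx (no-Kept x))) , (λ g → g) ]′ (∨⁻ e)))
             (subst (_≤ mass (λ x → Rc x ∨ Group x)) (+-comm (mass Rc) (mass Group))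
               (mass-split Rc Group (λ x → Rc x ∨ Group x) (λ x e1 e2 → true≢false (Group-scanned x e2) (fresh (Rc-below x e1))) (λ x e → ∨-introˡ e) (λ x e → ∨-introʳ {Rc x} e))))
          (interchange NB nb NF nf)

    group-child : (st : State u i) (ic : Outcome c) → Region.openTop (Outcome.piece ic) ≡ false → Region.hole (Outcome.piece ic) ≡ nothing →
      suc (count (λ x → State.Group st x ∨ Region.R (Outcome.piece ic) x)) ≤ k → State u (suc i)
    group-child st ic no-top no-hole-c Group'-small = record
      { Kept = Kept ; Group = Group' ; openTop = openTop ; keptHole = keptHole ; NB = NB + nb ; NF = NF + nf
      ; Kept-scanned = λ x h → Scanned-step (Kept-scanned x h) ; Group-scanned = Group-scanned'
      ; Kept-Group-disjoint = Kept-Group-disjoint' ; Kept-upward = Kept-upward ; Group-upward = Group-upward' ; exits = exits' ; Group-closed = Group-closed'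
      ; keptHole∈Kept = keptHole∈Kept ; no-hole-no-Kept = no-hole-no-Kept ; Kept-small = Kept-small ; Group-small = Group'-small
      ; potential = potential-+ NF nf (wt openTop keptHole) NB nb _ potential (subst (λ z → nf + z ≤ 2 * nb) (cong₂ wt no-top no-hole-c) potential-c)
      ; owned = owned' ; scanned-mass = scanned-mass' }
      where
        open ChildStep st ic
        Group' : Fin n → Bool
        Group' x = Group x ∨ Rc x
        Group-scanned' : ∀ x → Group' x ≡ true → Scanned u (suc i) x ≡ true
        Group-scanned' x h = [ (λ g → Scanned-step (Group-scanned x g)) , (λ o → new (Rc-below x o)) ]′ (∨⁻ h)
        Kept-Group-disjoint' : ∀ x → Kept x ≡ true → Group' x ≡ true → ⊥
        Kept-Group-disjoint' x kx h = [ Kept-Group-disjoint x kx , (λ o → true≢false (Kept-scanned x kx) (fresh (Rc-below x o))) ]′ (∨⁻ h)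
        Group-upward' : ∀ x → Group' x ≡ true → Group' (parent x) ≡ true ⊎ parent x ≡ u
        Group-upward' x h with ∨⁻ {Group x} h
        ... | inj₁ g = [ (λ g' → inj₁ (∨-introˡ g')) , inj₂ ]′ (Group-upward x g)
        ... | inj₂ o with x ≟ c
        ...   | yes refl = inj₂ parent-c
        ...   | no ne = inj₁ (∨-introʳ {Group (parent x)} (Rc-upward x o ne))
        Group-closed' : ∀ x → Group' x ≡ false → Group' (parent x) ≡ true → x ≢ root → ⊥
        Group-closed' x h1 h2 xr with ∨-false⁻ {Group x} h1
        ... | gx , ox with ∨⁻ {Group (parent x)} h2
        ... | inj₁ g = Group-closed x gx g xr
        ... | inj₂ o = sealed no-top no-hole-c x ox o (≼-unparent (Rc-below (parent x) o) xr)
        exits' : ∀ x → Scanned u (suc i) x ≡ true → Kept x ≡ false → Group' x ≡ false →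
            (parent x ≡ u ⊎ Kept (parent x) ≡ true ⊎ Group' (parent x) ≡ true) →
            (parent x ≡ u × openTop ≡ true) ⊎ keptHole ≡ just (parent x)
        exits' x d kx g'x w with ∨-false⁻ {Group x} g'x
        ... | gx , ox with split d
        ...   | inj₁ dx = exits x dx kx gx (w' w)
          where
            w' : (parent x ≡ u ⊎ Kept (parent x) ≡ true ⊎ Group' (parent x) ≡ true) → (parent x ≡ u ⊎ Kept (parent x) ≡ true ⊎ Group (parent x) ≡ true)
            w' (inj₁ e) = inj₁ e
            w' (inj₂ (inj₁ kk)) = inj₂ (inj₁ kk)
            w' (inj₂ (inj₂ h)) with ∨⁻ {Group (parent x)} h
            ... | inj₁ g = inj₂ (inj₂ g)
            ... | inj₂ o = ⊥-elim (old⇒parent⋠c dx (Rc-below (parent x) o))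
        ...   | inj₂ (_ , xc) = ⊥-elim (res w)
          where
            xnc : x ≢ c
            xnc e = true≢false (subst (λ z → Rc z ≡ true) (sym e) c∈Rc) ox
            pc : parent x ≼ c
            pc = ≼-parent xc xnc
            res : (parent x ≡ u ⊎ Kept (parent x) ≡ true ⊎ Group' (parent x) ≡ true) → ⊥
            res (inj₁ e) = parent⋠child ch (subst (_≼ c) e pc)
            res (inj₂ (inj₁ kk)) = true≢false (Kept-scanned (parent x) kk) (fresh pc)
            res (inj₂ (inj₂ h)) with ∨⁻ {Group (parent x)} h
            ... | inj₁ g = true≢false (Group-scanned (parent x) g) (fresh pc)
            ... | inj₂ o = sealed no-top no-hole-c x ox o xc
        A B T' : Fin n → Bool
        A x = Scanned u i x ∧ not (Kept x ∨ Group x)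
        B x = subtreeᵇ c x ∧ not (Rc x)
        T' x = Scanned u (suc i) x ∧ not (Kept x ∨ Group' x)
        owned' : k * (NB + nb) ≤ count T'
        owned' = begin
          k * (NB + nb) ≡⟨ *-distribˡ-+ k NB nb ⟩
          k * NB + k * nb ≤⟨ +-mono-≤ owned owned-c ⟩
          count A + count B ≤⟨ count-split A B T'
               (λ x e1 e2 → true≢false (proj₁ (∧⁻ {Scanned u i x} e1)) (fresh (subtreeᵇ-sound c x (proj₁ (∧⁻ {subtreeᵇ c x} e2)))))
               (λ x e → let (d , nk) = ∧⁻ {Scanned u i x} e in ∧-intro (Scanned-step d) (not-intro (∨-false (proj₁ (∨-false⁻ {Kept x} (not⁻ nk))) (∨-false (proj₂ (∨-false⁻ {Kept x} (not⁻ nk))) (Rc-fresh d)))))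
               (λ x e → let (sc , nO) = ∧⁻ {subtreeᵇ c x} e in ∧-intro (new (subtreeᵇ-sound c x sc)) (not-intro (∨-false (Kept-fresh (subtreeᵇ-sound c x sc)) (∨-false (Group-fresh (subtreeᵇ-sound c x sc)) (not⁻ nO))))) ⟩
          count T' ∎
          where open ≤-Reasoning
        scanned-mass' : K * mass (Scanned u (suc i)) ≤ K * mass (λ x → Kept x ∨ Group' x) + ((NB + nb) + (NF + nf)) * W
        scanned-mass' = covered-merge _ _ _ _ _ _ (NB + NF) (nb + nf) ((NB + nb) + (NF + nf))
          scanned-mass-step
          scanned-mass subtree-mass
          (mass-split (λ x → Kept x ∨ Group x) Rc (λ x → Kept x ∨ Group' x)
             (λ x e1 e2 → true≢false e1 (Kept∨Group-fresh (Rc-below x e2)))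
             (λ x e → [ (λ kk → ∨-introˡ {Kept x} {Group' x} kk) , (λ g → ∨-introʳ {Kept x} (∨-introˡ {Group x} {Rc x} g)) ]′ (∨⁻ {Kept x} e))
             (λ x e → ∨-introʳ {Kept x} (∨-introʳ {Group x} e)))
          (interchange NB nb NF nf)

    -- When Group and a sealed piece of c reach k vertices, u ∪ Group ∪ Rc forms
    -- a fan: a region with fewer than 2k vertices which is either heavy (Found)
    -- or closed as a big piece.
    module Fan (st : State u i) (ic : Outcome c) (no-top : Region.openTop (Outcome.piece ic) ≡ false) (no-hole-c : Region.hole (Outcome.piece ic) ≡ nothing)
               (small-c : suc (count (Region.R (Outcome.piece ic))) ≤ k) where
      open ChildStep st ic
      F : Fin n → Bool
      F x = eqᵇ x u ∨ (Group x ∨ Rc x)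
      u∈F : ∀ {y} → y ≡ u → F y ≡ true
      u∈F refl = ∨-introˡ (eqᵇ-refl u)
      F-below : ∀ x → F x ≡ true → x ≼ u
      F-below x h with ∨⁻ {eqᵇ x u} h
      ... | inj₁ e rewrite eqᵇ-sound e = ≼-refl u
      ... | inj₂ e with ∨⁻ {Group x} e
      ... | inj₁ g = proj₁ (Scanned⁻ {u} {i} {x} (Group-scanned x g))
      ... | inj₂ o = proj₁ (child-subtree ch (Rc-below x o))
      F-upward : ∀ x → F x ≡ true → x ≢ u → F (parent x) ≡ true
      F-upward x h ne with ∨⁻ {eqᵇ x u} h
      ... | inj₁ e = ⊥-elim (ne (eqᵇ-sound e))
      ... | inj₂ e with ∨⁻ {Group x} e
      ... | inj₁ g = [ (λ g' → ∨-introʳ {eqᵇ (parent x) u} (∨-introˡ g')) , u∈F ]′ (Group-upward x g)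
      ... | inj₂ o with x ≟ c
      ...   | yes refl = u∈F parent-c
      ...   | no nc = ∨-introʳ {eqᵇ (parent x) u} (∨-introʳ {Group (parent x)} (Rc-upward x o nc))
      F-exits : ∀ x → F x ≡ false → F (parent x) ≡ true → x ≢ root → (parent x ≡ u × true ≡ true) ⊎ nothing ≡ just (parent x)
      F-exits x h1 h2 xr with ∨-false⁻ {eqᵇ x u} h1
      ... | _ , gox with ∨-false⁻ {Group x} gox
      ... | gx , ox with ∨⁻ {eqᵇ (parent x) u} h2
      ... | inj₁ e = inj₁ (eqᵇ-sound e , refl)
      ... | inj₂ e with ∨⁻ {Group (parent x)} e
      ... | inj₁ g = ⊥-elim (Group-closed x gx g xr)
      ... | inj₂ o = ⊥-elim (sealed no-top no-hole-c x ox o (≼-unparent (Rc-below (parent x) o) xr))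
      fan : Region u
      fan = record { R = F ; openTop = true ; hole = nothing ; top∈R = u∈F refl ; R-below = F-below ; R-upward = F-upward ; R-exits = F-exits
                      ; hole∈R = λ p () }
      fan-small : suc (count F) ≤ k + k
      fan-small = begin
        suc (count F) ≤⟨ s≤s (count-∪ (λ x → eqᵇ x u) (λ x → Group x ∨ Rc x)) ⟩
        suc (count (λ x → eqᵇ x u) + count (λ x → Group x ∨ Rc x)) ≡⟨ cong (λ z → suc (z + count (λ x → Group x ∨ Rc x))) (count-one _ u (eqᵇ-refl u) (λ x → eqᵇ-sound)) ⟩
        suc (suc (count (λ x → Group x ∨ Rc x))) ≤⟨ s≤s (s≤s (count-∪ Group Rc)) ⟩
        suc (suc (count Group + count Rc)) ≡⟨ cong suc (sym (+-suc (count Group) (count Rc))) ⟩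
        suc (count Group) + suc (count Rc) ≤⟨ +-mono-≤ Group-small small-c ⟩
        k + k ∎
        where open ≤-Reasoning

      close-fan : k ≤ count (λ x → Group x ∨ Rc x) → suc (K * mass F) ≤ W → State u (suc i)
      close-fan big light = record
        { Kept = Kept ; Group = ∅ ; openTop = true ; keptHole = keptHole ; NB = NB + nb + 1 ; NF = NF + nf
        ; Kept-scanned = λ x h → Scanned-step (Kept-scanned x h) ; Group-scanned = λ _ () ; Kept-Group-disjoint = λ _ _ () ; Kept-upward = Kept-upward ; Group-upward = λ _ ()
        ; exits = exits' ; Group-closed = λ _ _ () ; keptHole∈Kept = keptHole∈Kept ; no-hole-no-Kept = no-hole-no-Kept ; Kept-small = Kept-small
        ; Group-small = subst (λ z → suc z ≤ k) (sym (count-none ∅ (λ _ → refl))) k≥1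
        ; potential = potential-big openTop keptHole NF nf NB nb _ potential potential-c ; owned = owned' ; scanned-mass = scanned-mass' }
        where
          exits' : ∀ x → Scanned u (suc i) x ≡ true → Kept x ≡ false → ∅ x ≡ false →
              (parent x ≡ u ⊎ Kept (parent x) ≡ true ⊎ ∅ (parent x) ≡ true) →
              (parent x ≡ u × true ≡ true) ⊎ keptHole ≡ just (parent x)
          exits' x d kx _ (inj₁ e) = inj₁ (e , refl)
          exits' x d kx _ (inj₂ (inj₂ ()))
          exits' x d kx _ (inj₂ (inj₁ kk)) with split d
          ... | inj₁ dx with Group x in eg
          ...   | false with exits x dx kx eg (inj₂ (inj₁ kk))
          ...     | inj₁ (e , _) = inj₁ (e , refl)
          ...     | inj₂ e = inj₂ e
          exits' x d kx _ (inj₂ (inj₁ kk)) | inj₁ dx | true with Group-upward x eg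
          ...     | inj₁ g = ⊥-elim (Kept-Group-disjoint (parent x) kk g)
          ...     | inj₂ e = inj₁ (e , refl)
          exits' x d kx _ (inj₂ (inj₁ kk)) | inj₂ (_ , xc) with x ≟ c
          ... | yes refl = inj₁ (parent-c , refl)
          ... | no nc = ⊥-elim (true≢false (Kept-scanned (parent x) kk) (fresh (≼-parent xc nc)))
          A B C T' : Fin n → Bool
          A x = Scanned u i x ∧ not (Kept x ∨ Group x)
          B x = subtreeᵇ c x ∧ not (Rc x)
          C x = Group x ∨ Rc x
          T' x = Scanned u (suc i) x ∧ not (Kept x ∨ ∅ x)
          AC : count A + count C ≤ count (λ x → A x ∨ C x)
          AC = count-disjoint A C λ x e1 e2 → let (d , nk) = ∧⁻ {Scanned u i x} e1 in
                 [ (λ g → true≢false g (proj₂ (∨-false⁻ {Kept x} (not⁻ nk)))) , (λ o → true≢false d (fresh (Rc-below x o))) ]′ (∨⁻ {Group x} e2)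
          ACB : count (λ x → A x ∨ C x) + count B ≤ count T'
          ACB = count-split (λ x → A x ∨ C x) B T'
            (λ x e1 e2 → let (sc , nO) = ∧⁻ {subtreeᵇ c x} e2 in let xc = subtreeᵇ-sound c x sc in
              [ (λ a → true≢false (proj₁ (∧⁻ {Scanned u i x} a)) (fresh xc)) ,
                (λ cc → [ (λ g → true≢false (Group-scanned x g) (fresh xc)) , (λ o → true≢false o (not⁻ nO)) ]′ (∨⁻ {Group x} cc)) ]′ (∨⁻ {A x} e1))
            (λ x e → [ (λ a → let (d , nk) = ∧⁻ {Scanned u i x} a in ∧-intro (Scanned-step d) (not-intro (∨-false (proj₁ (∨-false⁻ {Kept x} (not⁻ nk))) refl))) ,
                       (λ cc → [ (λ g → ∧-intro (Scanned-step (Group-scanned x g)) (not-intro (∨-false (Group⇒¬Kept g) refl))) ,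
                                 (λ o → ∧-intro (new (Rc-below x o)) (not-intro (∨-false (Kept-fresh (Rc-below x o)) refl))) ]′ (∨⁻ {Group x} cc)) ]′ (∨⁻ {A x} e))
            (λ x e → let (sc , nO) = ∧⁻ {subtreeᵇ c x} e in ∧-intro (new (subtreeᵇ-sound c x sc)) (not-intro (∨-false (Kept-fresh (subtreeᵇ-sound c x sc)) refl)))
          owned' : k * (NB + nb + 1) ≤ count T'
          owned' = begin
            k * (NB + nb + 1) ≤⟨ owned-big NB nb (count C) big ⟩
            (k * NB + k * nb) + count C ≤⟨ +-monoˡ-≤ (count C) (+-mono-≤ owned owned-c) ⟩
            (count A + count B) + count C ≡⟨ xy∙z≈xz∙y (count A) (count B) (count C) ⟩
            (count A + count C) + count B ≤⟨ +-monoˡ-≤ (count B) AC ⟩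
            count (λ x → A x ∨ C x) + count B ≤⟨ ACB ⟩
            count T' ∎
            where
              open ≤-Reasoning
          scanned-mass' : K * mass (Scanned u (suc i)) ≤ K * mass (λ x → Kept x ∨ ∅ x) + ((NB + nb + 1) + (NF + nf)) * W
          scanned-mass' = covered-close-fan _ _ _ _ _ (mass Kept) (mass F) _ (NB + NF) (nb + nf) ((NB + nb + 1) + (NF + nf))
            scanned-mass-step
            scanned-mass subtree-mass
            (begin
              mass (λ x → Kept x ∨ Group x) + mass Rc ≤⟨ +-monoˡ-≤ (mass Rc) (mass-∪ Kept Group (λ x → Kept x ∨ Group x) (λ x e → ∨⁻ e)) ⟩
              (mass Kept + mass Group) + mass Rc ≡⟨ +-assoc (mass Kept) (mass Group) (mass Rc) ⟩
              mass Kept + (mass Group + mass Rc) ≤⟨ +-monoʳ-≤ (mass Kept) (mass-split Group Rc F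
                   (λ x g o → true≢false (Group-scanned x g) (fresh (Rc-below x o))) (λ x g → ∨-introʳ {eqᵇ x u} (∨-introˡ g)) (λ x o → ∨-introʳ {eqᵇ x u} (∨-introʳ {Group x} o))) ⟩
              mass Kept + mass F ∎)
            light
            (mass-mono Kept (λ x → Kept x ∨ ∅ x) (λ x e → ∨-introˡ e))
            (count-big NB nb NF nf)
            where open ≤-Reasoning

    -- Close the piece of c as a forced piece, paid by the potential of the
    -- holes it would otherwise create.
    force-close : (st : State u i) (ic : Outcome c) →
      1 + wt true (State.keptHole st) ≤ wt (State.openTop st) (State.keptHole st) + wt (Region.openTop (Outcome.piece ic)) (Region.hole (Outcome.piece ic)) →
      Found ⊎ State u (suc i)
    force-close st ic hc with W ≤? K * mass (Region.R (Outcome.piece ic))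
    ... | yes heavy = inj₁ (c , Outcome.piece ic , Outcome.small ic , heavy)
    ... | no ¬heavy = inj₂ (close-child st ic (State.NB st + Outcome.nb ic) (State.NF st + Outcome.nf ic + 1)
              (count-forced (State.NB st) (Outcome.nb ic) (State.NF st) (Outcome.nf ic))
              (potential-trade (State.NF st) (State.NB st) (Outcome.nf ic) (Outcome.nb ic) _ _ 1 _ (State.potential st) (Outcome.potential ic) hc)
              (≤-trans (≤-reflexive (*-distribˡ-+ k (State.NB st) (Outcome.nb ic))) (m≤m+n _ _))
              (≰⇒> ¬heavy))

    keep-potential : ∀ (st : State u i) (ic : Outcome c) q → State.keptHole st ≡ nothing → wt (Region.openTop (Outcome.piece ic)) (Region.hole (Outcome.piece ic)) ≡ 2 →
       (State.NF st + Outcome.nf ic) + wt (State.openTop st) (just q) ≤ 2 * (State.NB st + Outcome.nb ic)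
    keep-potential st ic q ekh ew = subst (λ z → z + wt (State.openTop st) (just q) ≤ 2 * (State.NB st + Outcome.nb ic)) (+-identityʳ _)
      (potential-trade (State.NF st) (State.NB st) (Outcome.nf ic) (Outcome.nb ic) (wt (State.openTop st) nothing) 2 0 _
        (subst (λ z → State.NF st + wt (State.openTop st) z ≤ 2 * State.NB st) ekh (State.potential st))
        (subst (λ z → Outcome.nf ic + z ≤ 2 * Outcome.nb ic) ew (Outcome.potential ic))
        (wt-hole (State.openTop st) q))

    close-big : (st : State u i) (ic : Outcome c) → k ≤ count (Region.R (Outcome.piece ic)) → Found ⊎ State u (suc i)
    close-big st ic big with W ≤? K * mass (Region.R (Outcome.piece ic))
    ... | yes heavy = inj₁ (c , Outcome.piece ic , Outcome.small ic , heavy)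
    ... | no ¬heavy = inj₂ (close-child st ic (State.NB st + Outcome.nb ic + 1) (State.NF st + Outcome.nf ic)
              (count-big (State.NB st) (Outcome.nb ic) (State.NF st) (Outcome.nf ic))
              (potential-big (State.openTop st) (State.keptHole st) (State.NF st) (Outcome.nf ic) (State.NB st) (Outcome.nb ic) _
                 (State.potential st) (Outcome.potential ic))
              (owned-big (State.NB st) (Outcome.nb ic) _ big)
              (≰⇒> ¬heavy))

    group-or-fan : (st : State u i) (ic : Outcome c) → Region.openTop (Outcome.piece ic) ≡ false →
                   Region.hole (Outcome.piece ic) ≡ nothing → suc (count (Region.R (Outcome.piece ic))) ≤ k →
                   Found ⊎ State u (suc i)
    group-or-fan st ic no-top no-hole small with k ≤? count (λ x → State.Group st x ∨ Region.R (Outcome.piece ic) x)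
    ... | no ¬big = inj₂ (group-child st ic no-top no-hole (≰⇒> ¬big))
    ... | yes big with W ≤? K * mass (Fan.F st ic no-top no-hole small)
    ...   | yes heavy = inj₁ (u , Fan.fan st ic no-top no-hole small , Fan.fan-small st ic no-top no-hole small , heavy)
    ...   | no ¬heavy = inj₂ (Fan.close-fan st ic no-top no-hole small big (≰⇒> ¬heavy))

    -- The case analysis of one step: a big piece of c is closed; a small one is
    -- grouped (if sealed), kept (if it has one exit and nothing is kept yet), or
    -- force-closed.
    step-child : State u i → Outcome c → Found ⊎ State u (suc i)
    step-child st ic with k ≤? count (Region.R (Outcome.piece ic))
    ... | yes big = close-big st ic big
    step-child st ic | no small with Region.openTop (Outcome.piece ic) in etp | Region.hole (Outcome.piece ic) in edp
    ... | false | nothing = group-or-fan st ic etp edp (≰⇒> small)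
    ... | true | nothing = open-child
      where
        open-child : Found ⊎ State u (suc i)
        open-child with State.keptHole st in ekh
        ... | nothing = inj₂ (keep-child st ic ekh (≰⇒> small) c (Region.top∈R (Outcome.piece ic))
                 (λ { y (inj₁ (e , _)) → e ; y (inj₂ e) → ⊥-elim (nothing≢just (trans (sym edp) e)) })
                 (keep-potential st ic c ekh (cong₂ wt etp edp)))
        ... | just p = force-close st ic (subst₂ (λ z w → 1 + wt true z ≤ wt (State.openTop st) z + w) (sym ekh) (sym (cong₂ wt etp edp))
                 (wt-second-hole (State.openTop st) p true nothing (s≤s (s≤s z≤n))))
    ... | false | just q = holed-child
      where
        holed-child : Found ⊎ State u (suc i)
        holed-child with State.keptHole st in ekh
        ... | nothing = inj₂ (keep-child st ic ekh (≰⇒> small) q (proj₁ (Region.hole∈R (Outcome.piece ic) q edp))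
                 (λ { y (inj₁ (_ , t)) → ⊥-elim (true≢false t etp) ; y (inj₂ e) → just-injective (trans (sym e) edp) })
                 (keep-potential st ic q ekh (cong₂ wt etp edp)))
        ... | just p = force-close st ic (subst₂ (λ z w → 1 + wt true z ≤ wt (State.openTop st) z + w) (sym ekh) (sym (cong₂ wt etp edp))
                 (wt-second-hole (State.openTop st) p false (just q) (s≤s (s≤s z≤n))))
    ... | true | just q = force-close st ic (subst (λ w → 1 + wt true (State.keptHole st) ≤ wt (State.openTop st) (State.keptHole st) + w) (sym (cong₂ wt etp edp))
                 (wt-open-hole (State.openTop st) (State.keptHole st)))

  step-non-child : ∀ u c i → ¬ Child u c → toℕ c ≡ i → State u i → State u (suc i)
  step-non-child u c i nc ci st = record
    { Kept = Kept ; Group = Group ; openTop = openTop ; keptHole = keptHole ; NB = NB ; NF = NF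
    ; Kept-scanned = λ x h → trans (eqx x) (Kept-scanned x h) ; Group-scanned = λ x h → trans (eqx x) (Group-scanned x h)
    ; Kept-Group-disjoint = Kept-Group-disjoint ; Kept-upward = Kept-upward ; Group-upward = Group-upward ; exits = λ x d → exits x (trans (sym (eqx x)) d)
    ; Group-closed = Group-closed ; keptHole∈Kept = keptHole∈Kept ; no-hole-no-Kept = no-hole-no-Kept ; Kept-small = Kept-small ; Group-small = Group-small ; potential = potential
    ; owned = subst (k * NB ≤_) (count-cong _ _ λ x → cong (_∧ not (Kept x ∨ Group x)) (sym (eqx x))) owned
    ; scanned-mass = subst (λ z → K * z ≤ K * mass (λ x → Kept x ∨ Group x) + (NB + NF) * W)
                (count-cong _ _ λ x → cong (_∧ inL x) (sym (eqx x))) scanned-mass }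
    where
      open State st
      eqx : ∀ x → Scanned u (suc i) x ≡ Scanned u i x
      eqx = Scanned-skip nc ci

  mutual
    scan : ∀ f u → (∀ x → x ≼ u → depth x < depth u + f) → Found ⊎ Outcome u
    scan zero u h = ⊥-elim (<-irrefl (sym (+-identityʳ (depth u))) (h u (≼-refl u)))
    scan (suc f) u h with scan-children f u h n ≤-refl
    ... | inj₁ fd = inj₁ fd
    ... | inj₂ st = inj₂ (finish u st)

    scan-children : ∀ f u → (∀ x → x ≼ u → depth x < depth u + suc f) → ∀ i → i ≤ n → Found ⊎ State u i
    scan-children f u h zero _ = inj₂ (start u)
    scan-children f u h (suc i) le with scan-children f u h i (≤-trans (n≤1+n i) le)
    ... | inj₁ fd = inj₁ fd
    ... | inj₂ st = scan-child f u h i (fromℕ< le) (toℕ-fromℕ< le) st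

    scan-child : ∀ f u → (∀ x → x ≼ u → depth x < depth u + suc f) → ∀ i c → toℕ c ≡ i → State u i → Found ⊎ State u (suc i)
    scan-child f u h i c ci st with c ≟ root | parent c ≟ u
    ... | no cr | yes pc = child (scan f c h')
      where
        ch : Child u c
        ch = cr , pc
        h' : ∀ x → x ≼ c → depth x < depth c + f
        h' x xc = subst (depth x <_) (trans (+-suc (depth u) f) (cong (_+ f) (sym (depth-child ch)))) (h x (proj₁ (child-subtree ch xc)))
        child : Found ⊎ Outcome c → Found ⊎ State u (suc i)
        child (inj₁ fd) = inj₁ fd
        child (inj₂ ic) = Step.step-child u c i ch ci st ic
    ... | yes cr | _ = inj₂ (step-non-child u c i (λ ch → proj₁ ch cr) ci st)
    ... | no cr | no pc = inj₂ (step-non-child u c i (λ ch → pc (proj₂ ch)) ci st)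

  found→split : (∃ λ x → x ≢ root) → Found → Σ ℕ λ w → W ≤ K * w × Split (k + k) w
  found→split nr (t , g , sz , fd) = mass (Region.R g) , fd ,
     region→split g (k + k) (+-mono-≤ k≥1 k≥1) (≤-trans (n≤1+n _) sz) nr

  -- The scan of the whole tree finds a heavy region: otherwise the root piece
  -- and at most 3 n / k < K closed pieces, all light, would carry all of L.
  main : (∃ λ x → x ≢ root) → W ≡ mass (λ _ → true) →
         (∀ m → k * m ≤ n → suc (3 * m) ≤ K) → Σ ℕ λ w → W ≤ K * w × Split (k + k) w
  main nr hW HK with scan n root (λ x _ → subst (λ z → depth x < z + n) (sym depth-root) (depth<n x))
  ... | inj₁ fd = found→split nr fd
  ... | inj₂ ic with W ≤? K * mass (Region.R (Outcome.piece ic))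
  ...   | yes fd = found→split nr (root , Outcome.piece ic , Outcome.small ic , fd)
  ...   | no light = ⊥-elim (cover-impossible (mass (Region.R piece)) (nb + nf) root-mass (≰⇒> light) few)
    where
      open Outcome ic
      root-mass : K * W ≤ K * mass (Region.R piece) + (nb + nf) * W
      root-mass = subst (λ m → K * m ≤ K * mass (Region.R piece) + (nb + nf) * W)
        (trans (count-cong _ _ λ x → cong (_∧ inL x) (subtreeᵇ-complete root x (≼-root x))) (sym hW)) subtree-mass
      few : suc (nb + nf) ≤ K
      few = ≤-trans (s≤s (+-monoʳ-≤ nb (≤-trans (m≤m+n nf _) potential)))
              (subst (λ m → suc m ≤ K) (sym (three nb)) (HK nb (≤-trans owned (count≤n _))))
        where
          three : ∀ a → a + 2 * a ≡ 3 * a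
          three = solve-∀
-- Arithmetic of the parameters: for q = d + 1 and n ≥ 2q, the size unit
-- k = ⌊n / 2q⌋ is positive, pieces of fewer than 2k vertices have at most n / q
-- vertices, and k · m ≤ n forces 3m + 1 ≤ 12q + 1.
module Sizes (d n : ℕ) (2q≤n : suc d + suc d ≤ n) where

  open import Data.Nat hiding (_≟_)
  open import Data.Nat.Properties hiding (_≟_)
  open import Data.Nat.DivMod using (_/_; m≥n⇒m/n>0; m/n*n≤m; m≡m%n+[m/n]*n; m%n<n)
  open import Data.Empty using (⊥-elim)
  open import Relation.Nullary using (yes; no)
  open import Relation.Binary.PropositionalEquality
  open import Data.Nat.Tactic.RingSolver using (solve-∀)

  q 2q k : ℕ
  q = suc d
  2q = q + q
  k = n / 2q

  k≥1 : 1 ≤ k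
  k≥1 = m≥n⇒m/n>0 2q≤n

  piece-size : q * (k + k) ≤ n
  piece-size = subst (_≤ n) (swap k q) (m/n*n≤m n 2q)
    where
      swap : ∀ a b → a * (b + b) ≡ b * (a + a)
      swap = solve-∀

  few-pieces : ∀ m → k * m ≤ n → suc (3 * m) ≤ suc (12 * q)
  few-pieces m km≤n with m ≤? 4 * q
  ... | yes m≤4q = s≤s (subst (3 * m ≤_) (twelve q) (*-monoʳ-≤ 3 m≤4q))
    where
      twelve : ∀ a → 3 * (4 * a) ≡ 12 * a
      twelve = solve-∀
  ... | no m≰4q = ⊥-elim (<-irrefl refl (<-≤-trans n<2q+k2q (≤-trans 2q+k2q≤km km≤n)))
    where
      n<2q+k2q : n < 2q + k * 2q
      n<2q+k2q = subst (_< 2q + k * 2q) (sym (m≡m%n+[m/n]*n n 2q)) (+-monoˡ-< (k * 2q) (m%n<n n 2q))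
      double : ∀ a b → a * (4 * b) ≡ a * (b + b) + a * (b + b)
      double = solve-∀
      2q+k2q≤km : 2q + k * 2q ≤ k * m
      2q+k2q≤km = ≤-trans (+-monoˡ-≤ (k * 2q) (subst (_≤ k * 2q) (*-identityˡ 2q) (*-monoˡ-≤ 2q k≥1)))
                    (subst (_≤ k * m) (double k q) (*-monoʳ-≤ k (<⇒≤ (≰⇒> m≰4q))))

  2≤n : 2 ≤ n
  2≤n = ≤-trans (+-mono-≤ (s≤s z≤n) (s≤s z≤n)) 2q≤n

module Rationals where

  open import Data.Nat as ℕ using (ℕ; zero; suc; z≤n; s≤s)
  import Data.Nat.Properties as ℕ
  open import Data.Integer as ℤ using (+_; +≤+; +<+)
  import Data.Integer.Properties as ℤ
  open import Data.Rational using (ℚ; mkℚ; 0ℚ; _/_; _*_; _<_; toℚᵘ; *<*) renaming (_≤_ to _≤ℚ_)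
  open import Data.Rational.Properties using (toℚᵘ-cancel-≤; toℚᵘ-cancel-<; toℚᵘ-fromℚᵘ; toℚᵘ-homo-*)
  open import Data.Rational.Unnormalised as U using (ℚᵘ; mkℚᵘ; *≤*; _≃_)
  import Data.Rational.Unnormalised.Properties as U
  open import Data.Product using (Σ; _,_)
  open import Relation.Binary.PropositionalEquality

  ℕ→ℚᵘ : ℕ → ℚᵘ
  ℕ→ℚᵘ a = mkℚᵘ (+ a) 0

  ℕ→ℚᵘ-correct : ∀ a → toℚᵘ (+ a / 1) ≃ ℕ→ℚᵘ a
  ℕ→ℚᵘ-correct a = toℚᵘ-fromℚᵘ (ℕ→ℚᵘ a)

  ℕ→ℚ-mono : ∀ {a b} → a ℕ.≤ b → (+ a / 1) ≤ℚ (+ b / 1)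
  ℕ→ℚ-mono {a} {b} a≤b = toℚᵘ-cancel-≤ (U.≤-respˡ-≃ (U.≃-sym (ℕ→ℚᵘ-correct a)) (U.≤-respʳ-≃ (U.≃-sym (ℕ→ℚᵘ-correct b))
    (*≤* (subst₂ ℤ._≤_ (sym (ℤ.*-identityʳ (+ a))) (sym (ℤ.*-identityʳ (+ b))) (+≤+ a≤b)))))

  ε-scale : ∀ ε → 0ℚ < ε → Σ ℕ λ d → (∀ s n → suc d ℕ.* s ℕ.≤ n → (+ s / 1) ≤ℚ (ε * (+ n / 1)))
  ε-scale (mkℚ (+ zero) d _) (*<* (+<+ ()))
  ε-scale (mkℚ ℤ.-[1+ p ] d _) (*<* ())
  ε-scale ε@(mkℚ (+ suc p) d _) _ = d , λ s n ds≤n → toℚᵘ-cancel-≤ (U.≤-respˡ-≃ (U.≃-sym (ℕ→ℚᵘ-correct s))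
     (U.≤-respʳ-≃ (U.≃-sym (U.≃-trans (toℚᵘ-homo-* ε (+ n / 1)) (U.*-congˡ {mkℚᵘ (+ suc p) d} (ℕ→ℚᵘ-correct n))))
       (bound s n ds≤n)))
    where
      bound : ∀ s n → suc d ℕ.* s ℕ.≤ n → ℕ→ℚᵘ s U.≤ (mkℚᵘ (+ suc p) d U.* ℕ→ℚᵘ n)
      bound s n ds≤n = *≤* (subst₂ ℤ._≤_ (ℤ.pos-* s (suc d ℕ.* 1))
                      (trans (ℤ.pos-* (suc p ℕ.* n) 1) (cong (ℤ._* + 1) (ℤ.pos-* (suc p) n)))
                      (+≤+ cross))
        where
          cross : s ℕ.* (suc d ℕ.* 1) ℕ.≤ (suc p ℕ.* n) ℕ.* 1
          cross = subst₂ ℕ._≤_ (trans (ℕ.*-comm (suc d) s) (cong (s ℕ.*_) (sym (ℕ.*-identityʳ (suc d)))))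
                    (sym (ℕ.*-identityʳ _)) (ℕ.≤-trans ds≤n (ℕ.m≤m+n n (p ℕ.* n)))

  1/K>0 : ∀ K' → 0ℚ < (+ 1 / suc K')
  1/K>0 K' = toℚᵘ-cancel-< (U.<-respʳ-≃ (U.≃-sym (toℚᵘ-fromℚᵘ (mkℚᵘ (+ 1) K'))) (U.*<* (+<+ (s≤s z≤n))))

  1/K-bound : ∀ K' W w → W ℕ.≤ suc K' ℕ.* w → ((+ 1 / suc K') * (+ W / 1)) ≤ℚ (+ w / 1)
  1/K-bound K' W w W≤Kw = toℚᵘ-cancel-≤ (U.≤-respʳ-≃ (U.≃-sym (ℕ→ℚᵘ-correct w))
     (U.≤-respˡ-≃ (U.≃-sym (U.≃-trans (toℚᵘ-homo-* (+ 1 / suc K') (+ W / 1))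
                             (U.*-cong {toℚᵘ (+ 1 / suc K')} {mkℚᵘ (+ 1) K'} (toℚᵘ-fromℚᵘ (mkℚᵘ (+ 1) K')) (ℕ→ℚᵘ-correct W))))
       bound))
    where
      bound : (mkℚᵘ (+ 1) K' U.* ℕ→ℚᵘ W) U.≤ ℕ→ℚᵘ w
      bound = *≤* (subst₂ ℤ._≤_ (trans (ℤ.pos-* (1 ℕ.* W) 1) (cong (ℤ._* + 1) (ℤ.pos-* 1 W)))
                    (ℤ.pos-* w (suc K' ℕ.* 1))
                    (+≤+ cross))
        where
          cross : (1 ℕ.* W) ℕ.* 1 ℕ.≤ w ℕ.* (suc K' ℕ.* 1)
          cross = subst₂ ℕ._≤_ (sym (trans (ℕ.*-identityʳ _) (ℕ.*-identityˡ W)))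
                    (trans (ℕ.*-comm (suc K') w) (cong (w ℕ.*_) (sym (ℕ.*-identityʳ (suc K'))))) W≤Kw

open import Defs
open import Data.Nat using (ℕ; _≤_)
open import Data.Integer using (+_)
open import Data.Rational using (ℚ; 0ℚ; _/_; _*_; _<_) renaming (_≤_ to _≤ℚ_)
open import Data.Fin using (Fin)
open import Data.Fin.Subset using (Subset; _∈_; _∩_; ∣_∣)
open import Data.Product using (_×_; Σ; ∃)
open import Data.Sum using (_⊎_)
open import Relation.Nullary using (¬_)
open import Relation.Binary.PropositionalEquality using (_≡_)

import Data.Nat as ℕ
import Data.Nat.Properties as ℕ
import Data.Fin as Fin
import Data.Rational.Properties as ℚ
open import Data.Product using (_,_)
open import Relation.Binary.PropositionalEquality using (_≢_)

Solution : (ε β : ℚ) (n : ℕ) (E : Fin n → Fin n → Set) (L : Subset n) → Set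
Solution ε β n E L = ∃ λ (S : Subset n) → ∃ λ (T₁ : Subset n) → ∃ λ (T₂ : Subset n) →
  IsSubtree E S × IsSubtree E T₁ × IsSubtree E T₂
  × (∀ (v : Fin n) → v ∈ S ⊎ (v ∈ T₁ ⊎ v ∈ T₂))
  × ((+ ∣ S ∣ / 1) ≤ℚ (ε * (+ n / 1)))
  × ((β * (+ ∣ L ∣ / 1)) ≤ℚ (+ ∣ S ∩ L ∣ / 1))
  × (∀ (v : Fin n) → ¬ (v ∈ T₁ × v ∈ T₂))
  × ∣ S ∩ T₁ ∣ ≡ 1
  × ∣ S ∩ T₂ ∣ ≡ 1

other-vertex : ∀ {n} (r : Fin n) → 2 ≤ n → ∃ λ x → x ≢ r
other-vertex {ℕ.suc (ℕ.suc m)} Fin.zero _ = Fin.suc Fin.zero , λ ()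
other-vertex {ℕ.suc (ℕ.suc m)} (Fin.suc r) _ = Fin.zero , λ ()
other-vertex {ℕ.suc ℕ.zero} Fin.zero (ℕ.s≤s ())

rooted-solution : ∀ ε d → (∀ s n → ℕ.suc d ℕ.* s ≤ n → (+ s / 1) ≤ℚ (ε * (+ n / 1))) →
  ∀ n → ℕ.suc d ℕ.+ ℕ.suc d ≤ n → {E : Fin n → Fin n → Set} (E-sym : ∀ u v → E u v → E v u) →
  (ρ : RootedTrees.Rooting E) (L : Subset n) → Solution ε (+ 1 / ℕ.suc (12 ℕ.* ℕ.suc d)) n E L
rooted-solution ε d ε-small n 2q≤n E-sym ρ L
  with Scan.main (other-vertex root 2≤n) (Counting.∣∣≡count L) few-pieces
  where
    open Sizes d n 2q≤n
    module Scan = Decomposition E-sym ρ L k (ℕ.suc (12 ℕ.* q)) ∣ L ∣ k≥1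
    open RootedTrees.Rooting ρ using (root)
... | w , |L|≤Kw , S , T₁ , T₂ , S-tree , T₁-tree , T₂-tree , cover , |S|≤2k , w≤|S∩L| , disjoint , one₁ , one₂ =
  S , T₁ , T₂ , S-tree , T₁-tree , T₂-tree , cover ,
  ε-small ∣ S ∣ n (ℕ.≤-trans (ℕ.*-monoʳ-≤ (ℕ.suc d) |S|≤2k) piece-size) ,
  ℚ.≤-trans (Rationals.1/K-bound (12 ℕ.* ℕ.suc d) ∣ L ∣ w |L|≤Kw) (Rationals.ℕ→ℚ-mono w≤|S∩L|) ,
  disjoint , one₁ , one₂
  where open Sizes d n 2q≤n

lemma2p15 : (ε : ℚ) → 0ℚ < ε →
  Σ ℚ (λ β → 0ℚ < β × Σ ℕ (λ n₀ →
  (n : ℕ) → n₀ ≤ n → (E : Fin n → Fin n → Set) → IsTree n E →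
  (L : Subset n) →
  ∃ (λ (S : Subset n) → ∃ (λ (T₁ : Subset n) → ∃ (λ (T₂ : Subset n) →
  IsSubtree E S × IsSubtree E T₁ × IsSubtree E T₂
  × (∀ (v : Fin n) → v ∈ S ⊎ (v ∈ T₁ ⊎ v ∈ T₂))
  × ((+ ∣ S ∣ / 1) ≤ℚ (ε * (+ n / 1)))
  × ((β * (+ ∣ L ∣ / 1)) ≤ℚ (+ ∣ S ∩ L ∣ / 1))
  × (∀ (v : Fin n) → ¬ (v ∈ T₁ × v ∈ T₂))
  × ∣ S ∩ T₁ ∣ ≡ 1
  × ∣ S ∩ T₂ ∣ ≡ 1)))))
lemma2p15 ε 0<ε with Rationals.ε-scale ε 0<ε
... | d , ε-small = + 1 / ℕ.suc (12 ℕ.* ℕ.suc d) , Rationals.1/K>0 (12 ℕ.* ℕ.suc d) , ℕ.suc d ℕ.+ ℕ.suc d ,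
  λ n 2q≤n E (E-sym , _ , connected , _) L →
    rooted-solution ε d ε-small n 2q≤n E-sym (SpanningTree.rooting E connected) L
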